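{- Let $t \geq 3$ be an integer and let $E_1(t) = \frac{1}{2}\big(t + \sqrt{t^2-4}\big)$, a unit of norm $1$ of the real quadratic field $\mathbb{Q}(\sqrt{t^2-4})$. Then $E_1(t)$ is the square of a unit of norm $-1$ if and only if there exists an integer $t' \geq 1$ with $t = t'^2 + 2$, in which case $E_1(t) = \big(\frac{1}{2}(t' + \sqrt{t'^2+4})\big)^2$. Consequently, writing $t^2 - 4 = M(t) r(t)^2$ with $M(t)$ square-free and $r(t)\ge 1$, if $t$ is such that $M := M(t) \geq 2$ and $M(t_1) \neq M$ for all $1 \leq t_1 < t$, then $\frac{1}{2}\big(t + \sqrt{t^2-4}\big) = \varepsilon_M^2$ if $t-2$ is a perfect square, and $\frac{1}{2}\big(t + \sqrt{t^2-4}\big) = \varepsilon_M$ otherwise.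
   Context: $\varepsilon_M > 1$ denotes the fundamental unit of $\mathbb{Q}(\sqrt M)$. -}

module Defs where

open import Data.Nat as ℕ using (ℕ)
open import Data.Nat.Divisibility using (_∣_)
open import Data.Integer as ℤ using (ℤ; +_)
open import Data.Rational using (ℚ; _/_; _+_; _*_; _-_; -_; _<_; _≤_; 0ℚ; 1ℚ; ½)
open import Data.Product using (_×_; ∃)
open import Data.Sum using (_⊎_)
open import Relation.Nullary using (¬_)
open import Relation.Binary.PropositionalEquality using (_≡_)

-- An element  re + im·√D  of the quadratic field ℚ(√D)  (D a non-square).
record QF : Set where
  constructor mk
  field
    re : ℚ
    im : ℚ
open QF public

module _ (D : ℕ) where
  private
    d : ℚ
    d = + D / 1

  addQ : QF → QF → QF
  addQ (mk p q) (mk r s) = mk (p + r) (q + s)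

  subQ : QF → QF → QF
  subQ (mk p q) (mk r s) = mk (p - r) (q - s)

  mulQ : QF → QF → QF
  mulQ (mk p q) (mk r s) = mk (p * r + d * (q * s)) (p * s + q * r)

  sqQ : QF → QF
  sqQ x = mulQ x x

  traceQ : QF → ℚ
  traceQ (mk p q) = p + p

  normQ : QF → ℚ
  normQ (mk p q) = p * p - d * (q * q)

  -- positivity w.r.t. the real embedding with √D > 0 (x = p + q√D > 0)
  Pos : QF → Set
  Pos (mk p q) =
      (0ℚ ≤ p × 0ℚ ≤ q × ¬ (p ≡ 0ℚ × q ≡ 0ℚ))
    ⊎ (0ℚ ≤ p × q < 0ℚ × d * (q * q) < p * p)
    ⊎ (p < 0ℚ × 0ℚ < q × p * p < d * (q * q))

  GtQ : QF → QF → Set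
  GtQ x y = Pos (subQ x y)

oneQ : QF
oneQ = mk 1ℚ 0ℚ

IsIntℚ : ℚ → Set
IsIntℚ q = ∃ λ (z : ℤ) → q ≡ z / 1

module _ (D : ℕ) where
  -- algebraic integer of ℚ(√D): its characteristic polynomial
  -- X² - tr(x) X + N(x) has integer coefficients
  IsAlgInt : QF → Set
  IsAlgInt x = IsIntℚ (traceQ D x) × IsIntℚ (normQ D x)

  IsUnit : QF → Set
  IsUnit x = IsAlgInt x × ∃ λ y → IsAlgInt y × mulQ D x y ≡ oneQ

  IsFundamentalUnit : QF → Set
  IsFundamentalUnit ε =
    IsUnit ε × GtQ D ε oneQ ×
    (∀ u → IsUnit u → GtQ D u oneQ → u ≡ ε ⊎ GtQ D u ε)

SquareFree : ℕ → Set
SquareFree m = ∀ (k : ℕ) → (k ℕ.* k) ∣ m → k ≡ 1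

IsSquareℕ : ℕ → Set
IsSquareℕ n = ∃ λ (s : ℕ) → n ≡ s ℕ.* s

-- E₁(t) = (t + √(t²-4))/2  in ℚ(√(t²-4))
E₁ : ℕ → QF
E₁ t = mk (+ t / 2) ½

-- Write units of ℚ(√D) as (X + Y√D)/2.
--
-- If t = s² + 2 then t² − 4 = s²(s² + 4), so u = (s + √(s² + 4))/2 lies in ℚ(√(t² − 4)); it has
-- norm −1 and u² = E₁(t). Conversely tr(u)² = 2(Re u² + N u) for every u, so a square root of
-- E₁(t) of norm −1 has integral trace with tr(u)² = t − 2.
--
-- For the second part let η = (t + r√M)/2, a unit > 1 of norm 1, and ε = (x + y√M)/2 with x, y > 0
-- (M is square-free). If N ε = 1, minimality of t gives t ≤ x, hence η ≤ ε, so η = ε; and t − 2 is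
-- not a square, for otherwise its root u from the first part would be a unit of norm −1 with
-- 1 < u < u² = ε. If N ε = −1, then ε² = ((x² + 2) + xy√M)/2 has norm 1, so t ≤ x² + 2. Equality
-- gives η = ε². If t < x² + 2, then η > ε, and ηε⁻¹ = (α + β√M)/2 with 2α = Mry − tx, 2β = ty − rx
-- (both even by a parity argument) is a unit > 1; hence α ≥ x, whereas t < x² + 2 forces α < x.

module Submission where

open import Data.Nat as ℕ using (ℕ; zero; suc; NonZero; z≤n; s≤s)
import Data.Nat.Properties as ℕP
open import Data.Integer as ℤ using (ℤ; +_; -[1+_]; +≤+; +<+; -≤+; -<+; 0ℤ)
import Data.Integer.Properties as ℤP
open import Data.Rational as Q using (ℚ; _/_; ½; 0ℚ; 1ℚ; toℚᵘ)
import Data.Rational.Properties as QP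
open import Data.Rational.Unnormalised as U using (mkℚᵘ; *≡*; *≤*; *<*)
import Data.Rational.Unnormalised.Properties as UP
open import Data.Product using (_×_; _,_; proj₁; proj₂; Σ; ∃)
open import Data.Sum using (_⊎_; inj₁; inj₂; [_,_]′)
open import Data.Empty using (⊥; ⊥-elim)
open import Relation.Nullary using (¬_; Dec; yes; no; contradiction)
open import Relation.Binary.PropositionalEquality
open import Function using (_∘_; id)
open import Function.Bundles using (_⇔_; mk⇔)
import Data.Integer.Tactic.RingSolver as ℤSolver
import Data.Rational.Solver as ℚSolver

open import Defs

module Embedding where

  ι : ℤ → ℚ
  ι z = z / 1

  private
    toℚᵘ-ι : ∀ z → toℚᵘ (ι z) U.≃ mkℚᵘ z 0
    toℚᵘ-ι z = QP.toℚᵘ-fromℚᵘ (mkℚᵘ z 0)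

  ι-homo-+ : ∀ a b → ι (a ℤ.+ b) ≡ ι a Q.+ ι b
  ι-homo-+ a b = QP.toℚᵘ-injective (UP.≃-trans (toℚᵘ-ι (a ℤ.+ b)) (UP.≃-sym
    (UP.≃-trans (QP.toℚᵘ-homo-+ (ι a) (ι b))
      (UP.≃-trans (UP.+-cong (toℚᵘ-ι a) (toℚᵘ-ι b)) (*≡* (denominators-one a b))))))
    where
    denominators-one : ∀ a b → (a ℤ.* + 1 ℤ.+ b ℤ.* + 1) ℤ.* + 1 ≡ (a ℤ.+ b) ℤ.* + 1
    denominators-one = ℤSolver.solve-∀

  ι-homo-* : ∀ a b → ι (a ℤ.* b) ≡ ι a Q.* ι b
  ι-homo-* a b = QP.toℚᵘ-injective (UP.≃-trans (toℚᵘ-ι (a ℤ.* b)) (UP.≃-sym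
    (UP.≃-trans (QP.toℚᵘ-homo-* (ι a) (ι b))
      (UP.≃-trans (UP.*-cong (toℚᵘ-ι a) (toℚᵘ-ι b)) (*≡* refl)))))

  ι-homo‿- : ∀ a → ι (ℤ.- a) ≡ Q.- ι a
  ι-homo‿- a = QP.toℚᵘ-injective (UP.≃-trans (toℚᵘ-ι (ℤ.- a)) (UP.≃-sym
    (UP.≃-trans (QP.toℚᵘ-homo‿- (ι a)) (UP.≃-trans (UP.-‿cong (toℚᵘ-ι a)) (*≡* refl)))))

  ι-homo-− : ∀ a b → ι (a ℤ.- b) ≡ ι a Q.- ι b
  ι-homo-− a b = trans (ι-homo-+ a (ℤ.- b)) (cong (ι a Q.+_) (ι-homo‿- b))

  ι-injective : ∀ {a b} → ι a ≡ ι b → a ≡ b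
  ι-injective {a} {b} e with UP.≃-trans (UP.≃-sym (toℚᵘ-ι a)) (UP.≃-trans (QP.toℚᵘ-cong e) (toℚᵘ-ι b))
  ... | *≡* p = trans (sym (ℤP.*-identityʳ a)) (trans p (ℤP.*-identityʳ b))

  ι-mono-≤ : ∀ {a b} → a ℤ.≤ b → ι a Q.≤ ι b
  ι-mono-≤ {a} {b} p = QP.toℚᵘ-cancel-≤ (UP.≤-respˡ-≃ (UP.≃-sym (toℚᵘ-ι a))
    (UP.≤-respʳ-≃ (UP.≃-sym (toℚᵘ-ι b)) (*≤* (subst₂ ℤ._≤_ (sym (ℤP.*-identityʳ a)) (sym (ℤP.*-identityʳ b)) p))))

  ι-cancel-≤ : ∀ {a b} → ι a Q.≤ ι b → a ℤ.≤ b
  ι-cancel-≤ {a} {b} p with UP.≤-respˡ-≃ (toℚᵘ-ι a) (UP.≤-respʳ-≃ (toℚᵘ-ι b) (QP.toℚᵘ-mono-≤ p))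
  ... | *≤* q = subst₂ ℤ._≤_ (ℤP.*-identityʳ a) (ℤP.*-identityʳ b) q

  ι-mono-< : ∀ {a b} → a ℤ.< b → ι a Q.< ι b
  ι-mono-< {a} {b} p = QP.toℚᵘ-cancel-< (UP.<-respˡ-≃ (UP.≃-sym (toℚᵘ-ι a))
    (UP.<-respʳ-≃ (UP.≃-sym (toℚᵘ-ι b)) (*<* (subst₂ ℤ._<_ (sym (ℤP.*-identityʳ a)) (sym (ℤP.*-identityʳ b)) p))))

  ι-cancel-< : ∀ {a b} → ι a Q.< ι b → a ℤ.< b
  ι-cancel-< {a} {b} p with UP.<-respˡ-≃ (toℚᵘ-ι a) (UP.<-respʳ-≃ (toℚᵘ-ι b) (QP.toℚᵘ-mono-< p))
  ... | *<* q = subst₂ ℤ._<_ (ℤP.*-identityʳ a) (ℤP.*-identityʳ b) q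

  ι/2≡ι*½ : ∀ z → z / 2 ≡ ι z Q.* ½
  ι/2≡ι*½ z = QP.toℚᵘ-injective (UP.≃-trans (QP.toℚᵘ-fromℚᵘ (mkℚᵘ z 1)) (UP.≃-sym
    (UP.≃-trans (QP.toℚᵘ-homo-* (ι z) ½) (UP.≃-trans (UP.*-congʳ (toℚᵘ-ι z))
      (*≡* (cong (ℤ._* + 2) (ℤP.*-identityʳ z)))))))

module CommonDenominator where

  open Embedding
  open ℚSolver.+-*-Solver

  scaled : ℤ → ℤ → ℚ → QF
  scaled A B c = mk (ι A Q.* c) (ι B Q.* c)

  Posℤ : ℤ → ℤ → ℤ → Set
  Posℤ M P R =
      (0ℤ ℤ.≤ P × 0ℤ ℤ.≤ R × ¬ (P ≡ 0ℤ × R ≡ 0ℤ))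
    ⊎ (0ℤ ℤ.≤ P × R ℤ.< 0ℤ × M ℤ.* (R ℤ.* R) ℤ.< P ℤ.* P)
    ⊎ (P ℤ.< 0ℤ × 0ℤ ℤ.< R × P ℤ.* P ℤ.< M ℤ.* (R ℤ.* R))

  private
    ι*c-homo-* : ∀ A B c → (ι A Q.* c) Q.* (ι B Q.* c) ≡ ι (A ℤ.* B) Q.* (c Q.* c)
    ι*c-homo-* A B c = trans (solve 3 (λ a b c → (a :* c) :* (b :* c) := (a :* b) :* (c :* c)) refl (ι A) (ι B) c)
      (cong (Q._* (c Q.* c)) (sym (ι-homo-* A B)))

    ι*c-homo-+ : ∀ A B c → (ι A Q.* c) Q.+ (ι B Q.* c) ≡ ι (A ℤ.+ B) Q.* c
    ι*c-homo-+ A B c = trans (solve 3 (λ a b c → (a :* c) :+ (b :* c) := (a :+ b) :* c) refl (ι A) (ι B) c)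
      (cong (Q._* c) (sym (ι-homo-+ A B)))

    ι*c-homo-− : ∀ A B c → (ι A Q.* c) Q.- (ι B Q.* c) ≡ ι (A ℤ.- B) Q.* c
    ι*c-homo-− A B c = trans (solve 3 (λ a b c → (a :* c) :- (b :* c) := (a :- b) :* c) refl (ι A) (ι B) c)
      (cong (Q._* c) (sym (ι-homo-− A B)))

    ι-scale : ∀ D A c → ι D Q.* (ι A Q.* c) ≡ ι (D ℤ.* A) Q.* c
    ι-scale D A c = trans (sym (QP.*-assoc (ι D) (ι A) c)) (cong (Q._* c) (sym (ι-homo-* D A)))

    ι*c-homo-D* : ∀ D B E c → ι D Q.* ((ι B Q.* c) Q.* (ι E Q.* c)) ≡ ι (D ℤ.* (B ℤ.* E)) Q.* (c Q.* c)
    ι*c-homo-D* D B E c = trans (cong (ι D Q.*_) (ι*c-homo-* B E c)) (ι-scale D (B ℤ.* E) (c Q.* c))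

  scaled-norm : ∀ D A B c → normQ D (scaled A B c) ≡ ι (A ℤ.* A ℤ.- + D ℤ.* (B ℤ.* B)) Q.* (c Q.* c)
  scaled-norm D A B c = trans (cong₂ Q._-_ (ι*c-homo-* A A c) (ι*c-homo-D* (+ D) B B c))
    (ι*c-homo-− (A ℤ.* A) (+ D ℤ.* (B ℤ.* B)) (c Q.* c))

  scaled-trace : ∀ D A B c → traceQ D (scaled A B c) ≡ ι (A ℤ.+ A) Q.* c
  scaled-trace D A B c = ι*c-homo-+ A A c

  scaled-mul : ∀ D A B C E c → mulQ D (scaled A B c) (scaled C E c)
             ≡ scaled (A ℤ.* C ℤ.+ + D ℤ.* (B ℤ.* E)) (A ℤ.* E ℤ.+ B ℤ.* C) (c Q.* c)
  scaled-mul D A B C E c = cong₂ mk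
    (trans (cong₂ Q._+_ (ι*c-homo-* A C c) (ι*c-homo-D* (+ D) B E c))
           (ι*c-homo-+ (A ℤ.* C) (+ D ℤ.* (B ℤ.* E)) (c Q.* c)))
    (trans (cong₂ Q._+_ (ι*c-homo-* A E c) (ι*c-homo-* B C c)) (ι*c-homo-+ (A ℤ.* E) (B ℤ.* C) (c Q.* c)))

  scaled-sub : ∀ D A B C E c → subQ D (scaled A B c) (scaled C E c) ≡ scaled (A ℤ.- C) (B ℤ.- E) c
  scaled-sub D A B C E c = cong₂ mk (ι*c-homo-− A C c) (ι*c-homo-− B E c)

  module PositiveScale (c : ℚ) (0<c : 0ℚ Q.< c) where

    private
      instance
        c-pos : Q.Positive c
        c-pos = Q.positive 0<c

      0≡ι0*c : 0ℚ ≡ ι 0ℤ Q.* c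
      0≡ι0*c = sym (QP.*-zeroˡ c)

    *c-cancel-≤ : ∀ {A B} → ι A Q.* c Q.≤ ι B Q.* c → A ℤ.≤ B
    *c-cancel-≤ p = ι-cancel-≤ (QP.*-cancelʳ-≤-pos c p)

    *c-mono-≤ : ∀ {A B} → A ℤ.≤ B → ι A Q.* c Q.≤ ι B Q.* c
    *c-mono-≤ p = QP.*-monoʳ-≤-nonNeg c {{QP.pos⇒nonNeg c}} (ι-mono-≤ p)

    *c-cancel-< : ∀ {A B} → ι A Q.* c Q.< ι B Q.* c → A ℤ.< B
    *c-cancel-< p = ι-cancel-< (QP.*-cancelʳ-<-nonNeg c {{QP.pos⇒nonNeg c}} p)

    *c-mono-< : ∀ {A B} → A ℤ.< B → ι A Q.* c Q.< ι B Q.* c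
    *c-mono-< p = QP.*-monoˡ-<-pos c (ι-mono-< p)

    *c-injective : ∀ {A B} → ι A Q.* c ≡ ι B Q.* c → A ≡ B
    *c-injective e = ℤP.≤-antisym (*c-cancel-≤ (QP.≤-reflexive e)) (*c-cancel-≤ (QP.≤-reflexive (sym e)))

    0≤*c⇒0≤ : ∀ {A} → 0ℚ Q.≤ ι A Q.* c → 0ℤ ℤ.≤ A
    0≤*c⇒0≤ {A} p = *c-cancel-≤ (subst (Q._≤ ι A Q.* c) 0≡ι0*c p)

    0≤⇒0≤*c : ∀ {A} → 0ℤ ℤ.≤ A → 0ℚ Q.≤ ι A Q.* c
    0≤⇒0≤*c {A} p = subst (Q._≤ ι A Q.* c) (sym 0≡ι0*c) (*c-mono-≤ p)

    0<*c⇒0< : ∀ {A} → 0ℚ Q.< ι A Q.* c → 0ℤ ℤ.< A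
    0<*c⇒0< {A} p = *c-cancel-< (subst (Q._< ι A Q.* c) 0≡ι0*c p)

    0<⇒0<*c : ∀ {A} → 0ℤ ℤ.< A → 0ℚ Q.< ι A Q.* c
    0<⇒0<*c {A} p = subst (Q._< ι A Q.* c) (sym 0≡ι0*c) (*c-mono-< p)

    *c<0⇒<0 : ∀ {A} → ι A Q.* c Q.< 0ℚ → A ℤ.< 0ℤ
    *c<0⇒<0 {A} p = *c-cancel-< (subst (ι A Q.* c Q.<_) 0≡ι0*c p)

    <0⇒*c<0 : ∀ {A} → A ℤ.< 0ℤ → ι A Q.* c Q.< 0ℚ
    <0⇒*c<0 {A} p = subst (ι A Q.* c Q.<_) (sym 0≡ι0*c) (*c-mono-< p)

    *c≡0⇒≡0 : ∀ {A} → ι A Q.* c ≡ 0ℚ → A ≡ 0ℤ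
    *c≡0⇒≡0 e = *c-injective (trans e 0≡ι0*c)

    ≡0⇒*c≡0 : ∀ {A} → A ≡ 0ℤ → ι A Q.* c ≡ 0ℚ
    ≡0⇒*c≡0 refl = sym 0≡ι0*c

  module _ (c : ℚ) (0<c : 0ℚ Q.< c) (M : ℕ) (P R : ℤ) where

    private
      0<c*c : 0ℚ Q.< c Q.* c
      0<c*c = QP.positive⁻¹ (c Q.* c) {{QP.pos*pos⇒pos c {{Q.positive 0<c}} c {{Q.positive 0<c}}}}

      open PositiveScale c 0<c
      open PositiveScale (c Q.* c) 0<c*c using () renaming (*c-cancel-< to *c²-cancel-<; *c-mono-< to *c²-mono-<)

    Pos-scaled⇒Posℤ : Pos M (scaled P R c) → Posℤ (+ M) P R
    Pos-scaled⇒Posℤ (inj₁ (p , r , n)) =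
      inj₁ (0≤*c⇒0≤ p , 0≤*c⇒0≤ r , λ { (p≡0 , r≡0) → n (≡0⇒*c≡0 p≡0 , ≡0⇒*c≡0 r≡0) })
    Pos-scaled⇒Posℤ (inj₂ (inj₁ (p , r , e))) =
      inj₂ (inj₁ (0≤*c⇒0≤ p , *c<0⇒<0 r ,
        *c²-cancel-< (subst₂ Q._<_ (ι*c-homo-D* (+ M) R R c) (ι*c-homo-* P P c) e)))
    Pos-scaled⇒Posℤ (inj₂ (inj₂ (p , r , e))) =
      inj₂ (inj₂ (*c<0⇒<0 p , 0<*c⇒0< r ,
        *c²-cancel-< (subst₂ Q._<_ (ι*c-homo-* P P c) (ι*c-homo-D* (+ M) R R c) e)))

    Posℤ⇒Pos-scaled : Posℤ (+ M) P R → Pos M (scaled P R c)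
    Posℤ⇒Pos-scaled (inj₁ (p , r , n)) =
      inj₁ (0≤⇒0≤*c p , 0≤⇒0≤*c r , λ { (p≡0 , r≡0) → n (*c≡0⇒≡0 p≡0 , *c≡0⇒≡0 r≡0) })
    Posℤ⇒Pos-scaled (inj₂ (inj₁ (p , r , e))) =
      inj₂ (inj₁ (0≤⇒0≤*c p , <0⇒*c<0 r ,
        subst₂ Q._<_ (sym (ι*c-homo-D* (+ M) R R c)) (sym (ι*c-homo-* P P c)) (*c²-mono-< e)))
    Posℤ⇒Pos-scaled (inj₂ (inj₂ (p , r , e))) =
      inj₂ (inj₂ (<0⇒*c<0 p , 0<⇒0<*c r ,
        subst₂ Q._<_ (sym (ι*c-homo-* P P c)) (sym (ι*c-homo-D* (+ M) R R c)) (*c²-mono-< e)))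

  module _ (c : ℚ) (0<c : 0ℚ Q.< c) (M : ℕ) (A B C E : ℤ) where

    GtQ-scaled⇒Posℤ : GtQ M (scaled A B c) (scaled C E c) → Posℤ (+ M) (A ℤ.- C) (B ℤ.- E)
    GtQ-scaled⇒Posℤ g = Pos-scaled⇒Posℤ c 0<c M _ _ (subst (Pos M) (scaled-sub M A B C E c) g)

    Posℤ⇒GtQ-scaled : Posℤ (+ M) (A ℤ.- C) (B ℤ.- E) → GtQ M (scaled A B c) (scaled C E c)
    Posℤ⇒GtQ-scaled p = subst (Pos M) (sym (scaled-sub M A B C E c)) (Posℤ⇒Pos-scaled c 0<c M _ _ p)

module IntegerInequalities where

  open import Data.Integer using (_+_; _*_; _-_; -_; _≤_; _<_; _≤?_; _<?_)
  open ℤSolver using (solve-∀)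
  open CommonDenominator using (Posℤ)

  Nonneg : ℤ → Set
  Nonneg E = 0ℤ ≤ E

  nonneg-ℕ : ∀ n → Nonneg (+ n)
  nonneg-ℕ n = +≤+ z≤n

  nonneg-+ : ∀ {a b} → Nonneg a → Nonneg b → Nonneg (a + b)
  nonneg-+ = ℤP.+-mono-≤

  nonneg-* : ∀ {a b} → Nonneg a → Nonneg b → Nonneg (a * b)
  nonneg-* {+ m} {+ n} _ _ = subst Nonneg (ℤP.pos-* m n) (nonneg-ℕ _)

  nonneg-square : ∀ a → Nonneg (a * a)
  nonneg-square (+ m) = subst Nonneg (ℤP.pos-* m m) (nonneg-ℕ _)
  nonneg-square -[1+ m ] = nonneg-ℕ _

  nonneg-via : ∀ {E F} → E ≡ F → Nonneg F → Nonneg E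
  nonneg-via e = subst Nonneg (sym e)

  private
    pred-diff : ∀ a b → b - (+ 1 + a) ≡ b - a - + 1
    pred-diff = solve-∀

  <⇒nonneg-diff-1 : ∀ {a b} → a < b → Nonneg (b - a - + 1)
  <⇒nonneg-diff-1 {a} {b} p = subst Nonneg (pred-diff a b) (ℤP.i≤j⇒0≤j-i (ℤP.i<j⇒suc[i]≤j p))

  nonneg-diff-1⇒< : ∀ {a b} → Nonneg (b - a - + 1) → a < b
  nonneg-diff-1⇒< {a} {b} p = ℤP.suc[i]≤j⇒i<j (ℤP.0≤i-j⇒j≤i (subst Nonneg (sym (pred-diff a b)) p))

  <⇒0<-diff : ∀ {a b} → a < b → 0ℤ < b - a
  <⇒0<-diff {a} {b} a<b = nonneg-diff-1⇒< (nonneg-via (shift a b) (<⇒nonneg-diff-1 a<b))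
    where
    shift : ∀ a b → b - a - 0ℤ - + 1 ≡ b - a - + 1
    shift = solve-∀

  square-mono-≤ : ∀ {a b} → Nonneg a → a ≤ b → a * a ≤ b * b
  square-mono-≤ {+ m} {+ n} _ (+≤+ p) = subst₂ _≤_ (ℤP.pos-* m m) (ℤP.pos-* n n) (+≤+ (ℕP.*-mono-≤ p p))

  square-mono-< : ∀ {a b} → Nonneg a → a < b → a * a < b * b
  square-mono-< {+ m} {+ n} _ (+<+ p) = subst₂ _<_ (ℤP.pos-* m m) (ℤP.pos-* n n) (+<+ (ℕP.*-mono-< p p))

  square-cancel-≤ : ∀ {a b} → Nonneg b → a * a ≤ b * b → a ≤ b
  square-cancel-≤ {a} {b} nb p with a ≤? b
  ... | yes a≤b = a≤b
  ... | no a≰b = ⊥-elim (ℤP.<⇒≱ (square-mono-< nb (ℤP.≰⇒> a≰b)) p)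

  square-cancel-< : ∀ {a b} → Nonneg b → a * a < b * b → a < b
  square-cancel-< {a} {b} nb p with a <? b
  ... | yes a<b = a<b
  ... | no a≮b = ⊥-elim (ℤP.<⇒≱ p (square-mono-≤ nb (ℤP.≮⇒≥ a≮b)))

  *-cancelˡ-<-pos : ∀ {k a b} → 0ℤ < k → k * a < k * b → a < b
  *-cancelˡ-<-pos {k} 0<k = ℤP.*-cancelˡ-<-nonNeg k {{ℤ.nonNegative (ℤP.<⇒≤ 0<k)}}

  *-cancelˡ-≤-pos : ∀ {k a b} → 0ℤ < k → k * a ≤ k * b → a ≤ b
  *-cancelˡ-≤-pos {k} {a} {b} 0<k = ℤP.*-cancelˡ-≤-pos a b k {{ℤ.positive 0<k}}

  square-injective : ∀ {M a b} → 0ℤ < M → Nonneg a → Nonneg b → M * (a * a) ≡ M * (b * b) → a ≡ b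
  square-injective 0<M 0≤a 0≤b Ma²≡Mb² = ℤP.≤-antisym
    (square-cancel-≤ 0≤b (*-cancelˡ-≤-pos 0<M (ℤP.≤-reflexive Ma²≡Mb²)))
    (square-cancel-≤ 0≤a (*-cancelˡ-≤-pos 0<M (ℤP.≤-reflexive (sym Ma²≡Mb²))))

  ≡+4⇒-4≡ : ∀ a b → a ≡ b + + 4 → b ≡ a - + 4
  ≡+4⇒-4≡ a b e = trans (sym (cancel b)) (cong (_- + 4) (sym e))
    where
    cancel : ∀ b → b + + 4 - + 4 ≡ b
    cancel = solve-∀

  ¬Posℤ-nonPos : ∀ M P R → Nonneg M → Posℤ M P R → P ≤ 0ℤ → R ≤ 0ℤ → ⊥
  ¬Posℤ-nonPos M P R _ (inj₁ (0≤P , 0≤R , ¬P≡R≡0)) P≤0 R≤0 =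
    ¬P≡R≡0 (ℤP.≤-antisym P≤0 0≤P , ℤP.≤-antisym R≤0 0≤R)
  ¬Posℤ-nonPos M P R 0≤M (inj₂ (inj₁ (0≤P , _ , MR²<P²))) P≤0 _ with ℤP.≤-antisym P≤0 0≤P
  ... | refl = ℤP.<⇒≱ MR²<P² (nonneg-* 0≤M (nonneg-square R))
  ¬Posℤ-nonPos M P R _ (inj₂ (inj₂ (_ , 0<R , _))) _ R≤0 = ℤP.<⇒≱ 0<R R≤0

  Norm≡±4 : ℤ → ℤ → ℤ → Set
  Norm≡±4 M X Y = X * X - M * (Y * Y) ≡ + 4 ⊎ X * X - M * (Y * Y) ≡ -[1+ 3 ]

  Pell±4 : ℤ → ℤ → ℤ → Set
  Pell±4 M X Y = X * X ≡ M * (Y * Y) + + 4 ⊎ X * X + + 4 ≡ M * (Y * Y)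

  norm≡±4⇒pell±4 : ∀ M X Y → Norm≡±4 M X Y → Pell±4 M X Y
  norm≡±4⇒pell±4 M X Y norm = [ inj₁ ∘ plus , inj₂ ∘ minus ]′ norm
    where
    split : ∀ a b → a ≡ b + (a - b)
    split = solve-∀
    X²≡MY²+norm : X * X ≡ M * (Y * Y) + (X * X - M * (Y * Y))
    X²≡MY²+norm = split (X * X) (M * (Y * Y))
    plus : X * X - M * (Y * Y) ≡ + 4 → X * X ≡ M * (Y * Y) + + 4
    plus n≡4 = trans X²≡MY²+norm (cong (λ n → M * (Y * Y) + n) n≡4)
    cancel : ∀ b → b + -[1+ 3 ] + + 4 ≡ b
    cancel = solve-∀
    minus : X * X - M * (Y * Y) ≡ -[1+ 3 ] → X * X + + 4 ≡ M * (Y * Y)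
    minus n≡-4 = trans (cong (_+ + 4) (trans X²≡MY²+norm (cong (λ n → M * (Y * Y) + n) n≡-4))) (cancel (M * (Y * Y)))

  private
    ¬nonneg-norm-5 : ∀ M X Y → Norm≡±4 M X Y → ¬ Nonneg (X * X - M * (Y * Y) - + 5)
    ¬nonneg-norm-5 M X Y (inj₁ n≡4) h = contradiction (subst (λ n → Nonneg (n - + 5)) n≡4 h) λ ()
    ¬nonneg-norm-5 M X Y (inj₂ n≡-4) h = contradiction (subst (λ n → Nonneg (n - + 5)) n≡-4 h) λ ()

    ¬nonneg-neg-norm-5 : ∀ M X Y → Norm≡±4 M X Y → ¬ Nonneg (- (X * X - M * (Y * Y)) - + 5)
    ¬nonneg-neg-norm-5 M X Y (inj₁ n≡4) h = contradiction (subst (λ n → Nonneg (- n - + 5)) n≡4 h) λ ()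
    ¬nonneg-neg-norm-5 M X Y (inj₂ n≡-4) h = contradiction (subst (λ n → Nonneg (- n - + 5)) n≡-4 h) λ ()

  0<coordinates-of->1 : ∀ M X Y → Nonneg M → Norm≡±4 M X Y → Posℤ M (X - + 2) Y → 0ℤ < X × 0ℤ < Y
  0<coordinates-of->1 M X Y 0≤M norm (inj₁ (0≤X-2 , 0≤Y , ¬X-2≡Y≡0)) =
    ℤP.<-≤-trans (+<+ (s≤s z≤n)) (ℤP.0≤i-j⇒j≤i 0≤X-2) , ℤP.≤∧≢⇒< 0≤Y 0≢Y
    where
    0≢Y : 0ℤ ≢ Y
    0≢Y refl with X - + 2 ℤ.≟ 0ℤ
    ... | yes X-2≡0 = ¬X-2≡Y≡0 (X-2≡0 , refl)
    ... | no X-2≢0 = ¬nonneg-norm-5 M X Y norm (nonneg-via (identity X M)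
          (nonneg-+ (nonneg-* 0≤X-3 (nonneg-+ 0≤X-3 (nonneg-ℕ 6))) (nonneg-ℕ 4)))
      where
      0≤X-3 : Nonneg (X - + 2 - 0ℤ - + 1)
      0≤X-3 = <⇒nonneg-diff-1 (ℤP.≤∧≢⇒< 0≤X-2 (X-2≢0 ∘ sym))
      identity : ∀ X M → X * X - M * (0ℤ * 0ℤ) - + 5
                        ≡ (X - + 2 - 0ℤ - + 1) * ((X - + 2 - 0ℤ - + 1) + + 6) + + 4
      identity = solve-∀
  0<coordinates-of->1 M X Y 0≤M norm (inj₂ (inj₁ (0≤X-2 , _ , MY²<[X-2]²))) =
    ⊥-elim (¬nonneg-norm-5 M X Y norm (nonneg-via (identity X M Y)
      (nonneg-+ (<⇒nonneg-diff-1 MY²<[X-2]²) (nonneg-* (nonneg-ℕ 4) 0≤X-2))))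
    where
    identity : ∀ X M Y → X * X - M * (Y * Y) - + 5
                       ≡ (X - + 2) * (X - + 2) - M * (Y * Y) - + 1 + + 4 * (X - + 2)
    identity = solve-∀
  0<coordinates-of->1 M X Y 0≤M norm (inj₂ (inj₂ (_ , 0<Y , [X-2]²<MY²))) with 0ℤ <? X
  ... | yes 0<X = 0<X , 0<Y
  ... | no 0≮X = ⊥-elim (¬nonneg-neg-norm-5 M X Y norm (nonneg-via (identity X M Y)
        (nonneg-+ (<⇒nonneg-diff-1 [X-2]²<MY²) (nonneg-* (nonneg-ℕ 4) (ℤP.i≤j⇒0≤j-i (ℤP.≮⇒≥ 0≮X))))))
    where
    identity : ∀ X M Y → - (X * X - M * (Y * Y)) - + 5
                       ≡ M * (Y * Y) - (X - + 2) * (X - + 2) - + 1 + + 4 * (0ℤ - X)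
    identity = solve-∀

  Posℤ[2≤X] : ∀ M X Y → + 2 ≤ X → 0ℤ < Y → Posℤ M (X - + 2) Y
  Posℤ[2≤X] M X Y 2≤X 0<Y =
    inj₁ (ℤP.i≤j⇒0≤j-i 2≤X , ℤP.<⇒≤ 0<Y , λ { (_ , Y≡0) → ℤP.<⇒≢ 0<Y (sym Y≡0) })

  Posℤ[norm-4] : ∀ M X Y → 0ℤ < X → 0ℤ < Y → X * X + + 4 ≡ M * (Y * Y) → Posℤ M (X - + 2) Y
  Posℤ[norm-4] M X Y 0<X 0<Y norm with + 2 ≤? X
  ... | yes 2≤X = Posℤ[2≤X] M X Y 2≤X 0<Y
  ... | no 2≰X = inj₂ (inj₂ (X-2<0 , 0<Y , [X-2]²<MY²))
    where
    X-2<0 : X - + 2 < 0ℤ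
    X-2<0 = nonneg-diff-1⇒< (nonneg-via (shift X) (<⇒nonneg-diff-1 (ℤP.≰⇒> 2≰X)))
      where
      shift : ∀ X → 0ℤ - (X - + 2) - + 1 ≡ + 2 - X - + 1
      shift = solve-∀
    [X-2]²<MY² : (X - + 2) * (X - + 2) < M * (Y * Y)
    [X-2]²<MY² = nonneg-diff-1⇒< (nonneg-via (trans (cong (λ z → z - (X - + 2) * (X - + 2) - + 1) (sym norm)) (identity X))
                   (nonneg-+ (nonneg-* (nonneg-ℕ 4) (<⇒nonneg-diff-1 0<X)) (nonneg-ℕ 3)))
      where
      identity : ∀ X → (X * X + + 4) - (X - + 2) * (X - + 2) - + 1 ≡ + 4 * (X - 0ℤ - + 1) + + 3
      identity = solve-∀

  private
    ¬[0<i-j∧i<j] : ∀ i j → 0ℤ < i - j → i < j → ⊥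
    ¬[0<i-j∧i<j] i j 0<i-j i<j = contradiction
      (nonneg-via (sym (identity i j)) (nonneg-+ (<⇒nonneg-diff-1 0<i-j) (<⇒nonneg-diff-1 i<j))) λ ()
      where
      identity : ∀ i j → (i - j - 0ℤ - + 1) + (j - i - + 1) ≡ -[1+ 1 ]
      identity = solve-∀

  x≤a-of-Posℤ : ∀ M a b x y → 0ℤ < M → Nonneg a → Nonneg y →
    a * a + + 4 ≡ M * (b * b) → x * x + + 4 ≡ M * (y * y) → Posℤ M (a - x) (b - y) → x ≤ a
  x≤a-of-Posℤ M a b x y _ _ _ _ _ (inj₁ (0≤a-x , _ , _)) = ℤP.0≤i-j⇒j≤i 0≤a-x
  x≤a-of-Posℤ M a b x y _ _ _ _ _ (inj₂ (inj₁ (0≤a-x , _ , _))) = ℤP.0≤i-j⇒j≤i 0≤a-x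
  x≤a-of-Posℤ M a b x y 0<M 0≤a 0≤y a-norm x-norm (inj₂ (inj₂ (a-x<0 , 0<b-y , _))) =
    ⊥-elim (¬[0<i-j∧i<j] b y 0<b-y b<y)
    where
    a<x : a < x
    a<x = nonneg-diff-1⇒< (nonneg-via (sym (shift a x)) (<⇒nonneg-diff-1 a-x<0))
      where
      shift : ∀ a x → 0ℤ - (a - x) - + 1 ≡ x - a - + 1
      shift = solve-∀
    b<y : b < y
    b<y = square-cancel-< 0≤y (*-cancelˡ-<-pos 0<M
      (subst₂ _<_ a-norm x-norm (ℤP.+-monoˡ-< (+ 4) (square-mono-< 0≤a a<x))))

  Posℤ[s²-2s] : ∀ s .{{_ : NonZero s}} K ρ → 0ℤ < ρ → K * (ρ * ρ) ≡ + s * + s * (+ s * + s + + 4) →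
    Posℤ K (+ s * + s - + 2 * + s) ρ
  Posℤ[s²-2s] 1 K ρ 0<ρ Kρ²≡ = inj₂ (inj₂ (-<+ , 0<ρ , subst (+ 1 <_) (sym Kρ²≡) (+<+ (s≤s (s≤s z≤n)))))
  Posℤ[s²-2s] (suc (suc n)) K ρ 0<ρ _ =
    inj₁ (nonneg-via (factor (+ n)) (nonneg-* (nonneg-ℕ (suc (suc n))) (nonneg-ℕ n))
         , ℤP.<⇒≤ 0<ρ , λ { (_ , ρ≡0) → ℤP.<⇒≢ 0<ρ (sym ρ≡0) })
    where
    factor : ∀ n → (+ 2 + n) * (+ 2 + n) - + 2 * (+ 2 + n) ≡ (+ 2 + n) * n
    factor = solve-∀

  module MinimalNormFour {M t r : ℤ} (0<M : 0ℤ < M) (3≤t : + 3 ≤ t) (0≤r : Nonneg r)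
                         (t-norm : t * t ≡ M * (r * r) + + 4) where

    open ℤP.≤-Reasoning

    private
      0≤t : Nonneg t
      0≤t = ℤP.≤-trans (nonneg-ℕ 3) 3≤t

      0≤t-3 : Nonneg (t - + 3)
      0≤t-3 = ℤP.i≤j⇒0≤j-i 3≤t

      Mr²≡t²-4 : M * (r * r) ≡ t * t - + 4
      Mr²≡t²-4 = ≡+4⇒-4≡ (t * t) (M * (r * r)) t-norm

      Mr²≤x²-4 : ∀ {x} → t ≤ x → M * (r * r) ≤ x * x - + 4
      Mr²≤x²-4 t≤x = ℤP.≤-trans (ℤP.≤-reflexive Mr²≡t²-4) (ℤP.+-monoˡ-≤ (- + 4) (square-mono-≤ 0≤t t≤x))

    r≤y-of-t≤x : ∀ x y → Nonneg y → x * x ≡ M * (y * y) + + 4 → t ≤ x → r ≤ y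
    r≤y-of-t≤x x y 0≤y x-norm t≤x = square-cancel-≤ 0≤y (*-cancelˡ-≤-pos 0<M (begin
      M * (r * r)  ≤⟨ Mr²≤x²-4 t≤x ⟩
      x * x - + 4  ≡⟨ sym (≡+4⇒-4≡ (x * x) (M * (y * y)) x-norm) ⟩
      M * (y * y)  ∎))

    x<t-of-Posℤ : ∀ x y → Nonneg y → x * x + + 4 ≡ M * (y * y) → Posℤ M (t - x) (r - y) → x < t
    x<t-of-Posℤ x y 0≤y x-norm pos with x <? t
    ... | yes x<t = x<t
    ... | no x≮t = ⊥-elim (¬Posℤ-nonPos M (t - x) (r - y) (ℤP.<⇒≤ 0<M) pos
                             (ℤP.i≤j⇒i-j≤0 t≤x) (ℤP.i≤j⇒i-j≤0 r≤y))
      where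
      t≤x : t ≤ x
      t≤x = ℤP.≮⇒≥ x≮t
      r≤y : r ≤ y
      r≤y = square-cancel-≤ 0≤y (*-cancelˡ-≤-pos 0<M (begin
        M * (r * r)  ≤⟨ Mr²≤x²-4 t≤x ⟩
        x * x - + 4  ≤⟨ ℤP.+-monoʳ-≤ (x * x) -≤+ ⟩
        x * x + + 4  ≡⟨ x-norm ⟩
        M * (y * y)  ∎))

    x²+4<t² : ∀ x → Nonneg x → x < t → x * x + + 4 < t * t
    x²+4<t² x 0≤x x<t = nonneg-diff-1⇒< (case-split (+ 2 ≤? x))
      where
      case-split : Dec (+ 2 ≤ x) → Nonneg (t * t - (x * x + + 4) - + 1)
      case-split (yes 2≤x) = nonneg-via (identity t x) (nonneg-+
        (nonneg-* (<⇒nonneg-diff-1 x<t) (nonneg-+ (nonneg-+ 0≤t 0≤x) (nonneg-ℕ 1)))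
        (nonneg-* (nonneg-ℕ 2) (ℤP.i≤j⇒0≤j-i 2≤x)))
        where
        identity : ∀ t x → t * t - (x * x + + 4) - + 1 ≡ (t - x - + 1) * (t + x + + 1) + + 2 * (x - + 2)
        identity = solve-∀
      case-split (no 2≰x) = nonneg-via (identity t x) (nonneg-+ (nonneg-+
        (nonneg-* 0≤t-3 (nonneg-+ 0≤t (nonneg-ℕ 3)))
        (nonneg-* (<⇒nonneg-diff-1 (ℤP.≰⇒> 2≰x)) (nonneg-+ (nonneg-ℕ 1) 0≤x))) (nonneg-ℕ 3))
        where
        identity : ∀ t x → t * t - (x * x + + 4) - + 1 ≡ (t - + 3) * (t + + 3) + (+ 2 - x - + 1) * (+ 1 + x) + + 3
        identity = solve-∀

    tx<Mry : ∀ x y → Nonneg x → Nonneg y → x * x + + 4 ≡ M * (y * y) → x < t → t * x < M * r * y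
    tx<Mry x y 0≤x 0≤y x-norm x<t = square-cancel-< (nonneg-* (nonneg-* (ℤP.<⇒≤ 0<M) 0≤r) 0≤y) (begin-strict
      (t * x) * (t * x)                                     ≡⟨ expand t x ⟩
      t * t * (x * x) + + 4 * (x * x + + 4) - + 4 * (x * x + + 4)
        <⟨ ℤP.+-monoˡ-< (- (+ 4 * (x * x + + 4)))
             (ℤP.+-monoʳ-< (t * t * (x * x)) (ℤP.*-monoˡ-<-pos (+ 4) (x²+4<t² x 0≤x x<t))) ⟩
      t * t * (x * x) + + 4 * (t * t) - + 4 * (x * x + + 4)  ≡⟨ factor t x ⟩
      (t * t - + 4) * (x * x + + 4)                          ≡⟨ cong₂ _*_ (sym Mr²≡t²-4) x-norm ⟩
      M * (r * r) * (M * (y * y))                            ≡⟨ regroup M r y ⟩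
      (M * r * y) * (M * r * y)                              ∎)
      where
      expand : ∀ t x → (t * x) * (t * x) ≡ t * t * (x * x) + + 4 * (x * x + + 4) - + 4 * (x * x + + 4)
      expand = solve-∀
      factor : ∀ t x → t * t * (x * x) + + 4 * (t * t) - + 4 * (x * x + + 4) ≡ (t * t - + 4) * (x * x + + 4)
      factor = solve-∀
      regroup : ∀ M r y → M * (r * r) * (M * (y * y)) ≡ (M * r * y) * (M * r * y)
      regroup = solve-∀

    rx<ty : ∀ x y → Nonneg y → x * x + + 4 ≡ M * (y * y) → r * x < t * y
    rx<ty x y 0≤y x-norm = square-cancel-< (nonneg-* 0≤t 0≤y) (*-cancelˡ-<-pos 0<M (begin-strict
      M * ((r * x) * (r * x))    ≡⟨ regroup M r x ⟩
      M * (r * r) * (x * x)      ≡⟨ cong (_* (x * x)) Mr²≡t²-4 ⟩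
      (t * t - + 4) * (x * x)    <⟨ nonneg-diff-1⇒< (nonneg-via (identity t x)
                                      (nonneg-+ (nonneg-+ (nonneg-* (nonneg-ℕ 4) (nonneg-* 0≤t-3 (nonneg-+ 0≤t (nonneg-ℕ 3))))
                                        (nonneg-* (nonneg-ℕ 4) (nonneg-square x))) (nonneg-ℕ 35))) ⟩
      t * t * (x * x + + 4)      ≡⟨ cong (t * t *_) x-norm ⟩
      t * t * (M * (y * y))      ≡⟨ regroup' M t y ⟩
      M * ((t * y) * (t * y))    ∎))
      where
      regroup : ∀ M r x → M * ((r * x) * (r * x)) ≡ M * (r * r) * (x * x)
      regroup = solve-∀
      regroup' : ∀ M t y → t * t * (M * (y * y)) ≡ M * ((t * y) * (t * y))
      regroup' = solve-∀
      identity : ∀ t x → t * t * (x * x + + 4) - (t * t - + 4) * (x * x) - + 1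
                         ≡ + 4 * ((t - + 3) * (t + + 3)) + + 4 * (x * x) + + 35
      identity = solve-∀

    quotient-norm : ∀ x y a b → x * x + + 4 ≡ M * (y * y) →
      + 2 * a ≡ M * r * y - t * x → + 2 * b ≡ t * y - r * x → a * a + + 4 ≡ M * (b * b)
    quotient-norm x y a b x-norm 2a≡ 2b≡ = ℤP.*-cancelˡ-≡ (+ 4) (a * a + + 4) (M * (b * b)) (begin-equality
      + 4 * (a * a + + 4)                                            ≡⟨ double a ⟩
      (+ 2 * a) * (+ 2 * a) + + 4 * + 4
        ≡⟨ cong₂ (λ u v → u * u + v) 2a≡ (cong₂ _*_ (sym t²-Mr²≡4) (sym My²-x²≡4)) ⟩
      (M * r * y - t * x) * (M * r * y - t * x) + (t * t - M * (r * r)) * (M * (y * y) - x * x)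
                                                                     ≡⟨ brahmagupta M t r x y ⟩
      M * ((t * y - r * x) * (t * y - r * x))                        ≡⟨ cong (λ v → M * (v * v)) (sym 2b≡) ⟩
      M * ((+ 2 * b) * (+ 2 * b))                                    ≡⟨ double' M b ⟩
      + 4 * (M * (b * b))                                            ∎)
      where
      n+4-n≡4 : ∀ n → n + + 4 - n ≡ + 4
      n+4-n≡4 = solve-∀
      t²-Mr²≡4 : t * t - M * (r * r) ≡ + 4
      t²-Mr²≡4 = trans (cong (_- M * (r * r)) t-norm) (n+4-n≡4 (M * (r * r)))
      My²-x²≡4 : M * (y * y) - x * x ≡ + 4
      My²-x²≡4 = trans (cong (_- x * x) (sym x-norm)) (n+4-n≡4 (x * x))
      double : ∀ a → + 4 * (a * a + + 4) ≡ (+ 2 * a) * (+ 2 * a) + + 4 * + 4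
      double = solve-∀
      double' : ∀ M b → M * ((+ 2 * b) * (+ 2 * b)) ≡ + 4 * (M * (b * b))
      double' = solve-∀
      brahmagupta : ∀ M t r x y → (M * r * y - t * x) * (M * r * y - t * x) + (t * t - M * (r * r)) * (M * (y * y) - x * x)
                                ≡ M * ((t * y - r * x) * (t * y - r * x))
      brahmagupta = solve-∀

    a<x-of-t<x²+2 : ∀ x y a → Nonneg x → x * x + + 4 ≡ M * (y * y) →
      + 2 * a ≡ M * r * y - t * x → t < x * x + + 2 → a < x
    a<x-of-t<x²+2 x y a 0≤x x-norm 2a≡ t<x²+2 = *-cancelˡ-<-pos {+ 2} (+<+ (s≤s z≤n)) (begin-strict
      + 2 * a                      ≡⟨ 2a≡ ⟩
      M * r * y - t * x            <⟨ ℤP.+-monoˡ-< (- (t * x)) Mry<x[t+2] ⟩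
      x * (t + + 2) - t * x        ≡⟨ cancel t x ⟩
      + 2 * x                      ∎)
      where
      cancel : ∀ t x → x * (t + + 2) - t * x ≡ + 2 * x
      cancel = solve-∀
      regroup : ∀ M r y → (M * r * y) * (M * r * y) ≡ M * (r * r) * (M * (y * y))
      regroup = solve-∀
      identity : ∀ t x → (x * (t + + 2)) * (x * (t + + 2)) - (t * t - + 4) * (x * x + + 4) - + 1
                         ≡ + 4 * (t + + 2) * (x * x + + 2 - t - + 1) + (+ 4 * t + + 7)
      identity = solve-∀
      Mry<x[t+2] : M * r * y < x * (t + + 2)
      Mry<x[t+2] = square-cancel-< (nonneg-* 0≤x (nonneg-+ 0≤t (nonneg-ℕ 2))) (begin-strict
        (M * r * y) * (M * r * y)          ≡⟨ regroup M r y ⟩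
        M * (r * r) * (M * (y * y))        ≡⟨ cong₂ _*_ Mr²≡t²-4 (sym x-norm) ⟩
        (t * t - + 4) * (x * x + + 4)      <⟨ nonneg-diff-1⇒< (nonneg-via (identity t x)
                                               (nonneg-+ (nonneg-* (nonneg-* (nonneg-ℕ 4) (nonneg-+ 0≤t (nonneg-ℕ 2)))
                                                                   (<⇒nonneg-diff-1 t<x²+2))
                                                         (nonneg-+ (nonneg-* (nonneg-ℕ 4) 0≤t) (nonneg-ℕ 7)))) ⟩
        (x * (t + + 2)) * (x * (t + + 2))  ∎)

module Parity where

  open import Data.Integer using (_+_; _*_; _-_; -_)
  open ℤSolver using (solve-∀)

  infix 4 _≡₂_
  _≡₂_ : ℤ → ℤ → Set
  a ≡₂ b = Σ ℤ λ k → a ≡ b + + 2 * k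

  Even : ℤ → Set
  Even z = Σ ℤ λ k → + 2 * k ≡ z

  private
    square-parityℕ : ∀ n → Σ ℕ λ k → n ℕ.* n ≡ n ℕ.+ 2 ℕ.* k
    square-parityℕ zero = 0 , refl
    square-parityℕ (suc n) with square-parityℕ n
    ... | k , n²≡ = k ℕ.+ n , trans (expand n) (trans (cong (λ m → m ℕ.+ 2 ℕ.* n ℕ.+ 1) n²≡) (collect n k))
      where
      open import Data.Nat.Tactic.RingSolver using () renaming (solve-∀ to solveℕ-∀)
      expand : ∀ n → suc n ℕ.* suc n ≡ n ℕ.* n ℕ.+ 2 ℕ.* n ℕ.+ 1
      expand = solveℕ-∀
      collect : ∀ n k → n ℕ.+ 2 ℕ.* k ℕ.+ 2 ℕ.* n ℕ.+ 1 ≡ suc n ℕ.+ 2 ℕ.* (k ℕ.+ n)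
      collect = solveℕ-∀

  square≡₂ : ∀ n → + n * + n ≡₂ + n
  square≡₂ n with square-parityℕ n
  ... | k , n²≡ = + k , (begin
    + n * + n             ≡⟨ ℤP.pos-* n n ⟨
    + (n ℕ.* n)           ≡⟨ cong +_ n²≡ ⟩
    + (n ℕ.+ 2 ℕ.* k)     ≡⟨ ℤP.pos-+ n (2 ℕ.* k) ⟩
    + n + + (2 ℕ.* k)     ≡⟨ cong (λ m → + n + m) (ℤP.pos-* 2 k) ⟩
    + n + + 2 * + k       ∎)
    where open ≡-Reasoning

  ≡₂-of-squares : ∀ A B C D → A * A ≡₂ A → B * B ≡₂ B → A * A ≡ C * (B * B) + + 2 * D → A ≡₂ C * B
  ≡₂-of-squares A B C D (kA , A²≡) (kB , B²≡) A²≡CB²+2D = D - kA + C * kB , (begin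
    A                                    ≡⟨ add-sub A kA ⟩
    A + + 2 * kA - + 2 * kA              ≡⟨ cong (_- + 2 * kA) (sym A²≡) ⟩
    A * A - + 2 * kA                     ≡⟨ cong (_- + 2 * kA) A²≡CB²+2D ⟩
    C * (B * B) + + 2 * D - + 2 * kA     ≡⟨ cong (λ b → C * b + + 2 * D - + 2 * kA) B²≡ ⟩
    C * (B + + 2 * kB) + + 2 * D - + 2 * kA   ≡⟨ collect B C D kA kB ⟩
    C * B + + 2 * (D - kA + C * kB)      ∎)
    where
    open ≡-Reasoning
    add-sub : ∀ A k → A ≡ A + + 2 * k - + 2 * k
    add-sub = solve-∀
    collect : ∀ B C D kA kB → C * (B + + 2 * kB) + + 2 * D - + 2 * kA ≡ C * B + + 2 * (D - kA + C * kB)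
    collect = solve-∀

  Mry-tx-even : ∀ M t r x y → t ≡₂ M * r → x ≡₂ M * y → M * M ≡₂ M → Even (M * r * y - t * x)
  Mry-tx-even M _ r _ y (k₁ , refl) (k₂ , refl) (kM , M²≡) =
    - (kM * r * y) - M * r * k₂ - k₁ * M * y - + 2 * k₁ * k₂ , (begin
    + 2 * (- (kM * r * y) - M * r * k₂ - k₁ * M * y - + 2 * k₁ * k₂)
      ≡⟨ expand M r y k₁ k₂ kM ⟩
    M * r * y - (M * r + + 2 * k₁) * (M * y + + 2 * k₂) + r * y * (M * M - (M + + 2 * kM))
      ≡⟨ cong (λ m → M * r * y - (M * r + + 2 * k₁) * (M * y + + 2 * k₂) + r * y * (m - (M + + 2 * kM))) M²≡ ⟩
    M * r * y - (M * r + + 2 * k₁) * (M * y + + 2 * k₂) + r * y * ((M + + 2 * kM) - (M + + 2 * kM))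
      ≡⟨ cancel M r y k₁ k₂ kM ⟩
    M * r * y - (M * r + + 2 * k₁) * (M * y + + 2 * k₂)  ∎)
    where
    open ≡-Reasoning
    expand : ∀ M r y k₁ k₂ kM → + 2 * (- (kM * r * y) - M * r * k₂ - k₁ * M * y - + 2 * k₁ * k₂)
           ≡ M * r * y - (M * r + + 2 * k₁) * (M * y + + 2 * k₂) + r * y * (M * M - (M + + 2 * kM))
    expand = solve-∀
    cancel : ∀ M r y k₁ k₂ kM
           → M * r * y - (M * r + + 2 * k₁) * (M * y + + 2 * k₂) + r * y * ((M + + 2 * kM) - (M + + 2 * kM))
           ≡ M * r * y - (M * r + + 2 * k₁) * (M * y + + 2 * k₂)
    cancel = solve-∀

  ty-rx-even : ∀ M t r x y → t ≡₂ M * r → x ≡₂ M * y → Even (t * y - r * x)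
  ty-rx-even M _ r _ y (k₁ , refl) (k₂ , refl) = k₁ * y - r * k₂ , expand M r y k₁ k₂
    where
    expand : ∀ M r y k₁ k₂ → + 2 * (k₁ * y - r * k₂) ≡ (M * r + + 2 * k₁) * y - r * (M * y + + 2 * k₂)
    expand = solve-∀

module Units where

  open Embedding
  open ℚSolver.+-*-Solver

  isUnit-of-trace-norm : ∀ K x T e → traceQ K x ≡ ι T → normQ K x ≡ ι e → e ℤ.* e ≡ + 1 → IsUnit K x
  isUnit-of-trace-norm K x@(mk p q) T e tr nm e²≡1 =
    ((T , tr) , (e , nm)) , x⁻¹ , ((e ℤ.* T , tr⁻¹) , (e ℤ.* e ℤ.* e , nm⁻¹)) , x*x⁻¹≡1
    where
    d : ℚ
    d = ι (+ K)
    x⁻¹ : QF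
    x⁻¹ = mk (ι e Q.* p) (Q.- (ι e Q.* q))
    tr⁻¹ : traceQ K x⁻¹ ≡ ι (e ℤ.* T)
    tr⁻¹ = trans (solve 2 (λ e p → e :* p :+ e :* p := e :* (p :+ p)) refl (ι e) p)
      (trans (cong (ι e Q.*_) tr) (sym (ι-homo-* e T)))
    nm⁻¹ : normQ K x⁻¹ ≡ ι (e ℤ.* e ℤ.* e)
    nm⁻¹ = trans (solve 4 (λ e p q d → e :* p :* (e :* p) :- d :* ((:- (e :* q)) :* (:- (e :* q)))
                                       := (e :* e) :* (p :* p :- d :* (q :* q))) refl (ι e) p q d)
      (trans (cong₂ Q._*_ (sym (ι-homo-* e e)) nm) (sym (ι-homo-* (e ℤ.* e) e)))
    x*x⁻¹≡1 : mulQ K x x⁻¹ ≡ oneQ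
    x*x⁻¹≡1 = cong₂ mk
      (trans (solve 4 (λ e p q d → p :* (e :* p) :+ d :* (q :* (:- (e :* q))) := e :* (p :* p :- d :* (q :* q))) refl (ι e) p q d)
        (trans (cong (ι e Q.*_) nm) (trans (sym (ι-homo-* e e)) (cong ι e²≡1))))
      (solve 3 (λ e p q → p :* (:- (e :* q)) :+ q :* (e :* p) := con 0ℚ) refl (ι e) p q)

  normQ-mul : ∀ K x y → normQ K (mulQ K x y) ≡ normQ K x Q.* normQ K y
  normQ-mul K (mk p q) (mk r s) = solve 5 (λ p q r s d →
     (p :* r :+ d :* (q :* s)) :* (p :* r :+ d :* (q :* s)) :- d :* ((p :* s :+ q :* r) :* (p :* s :+ q :* r))
     := (p :* p :- d :* (q :* q)) :* (r :* r :- d :* (s :* s))) refl p q r s (ι (+ K))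

  normQ-one : ∀ K → normQ K oneQ ≡ 1ℚ
  normQ-one K = solve 1 (λ d → con 1ℚ :* con 1ℚ :- d :* (con 0ℚ :* con 0ℚ) := con 1ℚ) refl (ι (+ K))

  private
    ±1-of-*≡1 : ∀ e e' → e ℤ.* e' ≡ + 1 → e ≡ + 1 ⊎ e ≡ -[1+ 0 ]
    ±1-of-*≡1 e e' ee'≡1
      with ℕP.m*n≡1⇒m≡1 ℤ.∣ e ∣ ℤ.∣ e' ∣ (trans (sym (ℤP.abs-* e e')) (cong ℤ.∣_∣ ee'≡1))
    ±1-of-*≡1 (+ .1) e' _ | refl = inj₁ refl
    ±1-of-*≡1 -[1+ .0 ] e' _ | refl = inj₂ refl

  unit-norm≡±1 : ∀ K x → IsUnit K x → Σ ℤ λ e → normQ K x ≡ ι e × (e ≡ + 1 ⊎ e ≡ -[1+ 0 ])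
  unit-norm≡±1 K x ((_ , (e , nx≡e)) , y , ((_ , (e' , ny≡e')) , xy≡1)) = e , nx≡e , ±1-of-*≡1 e e' ee'≡1
    where
    open ≡-Reasoning
    ee'≡1 : e ℤ.* e' ≡ + 1
    ee'≡1 = ι-injective (begin
      ι (e ℤ.* e')              ≡⟨ ι-homo-* e e' ⟩
      ι e Q.* ι e'              ≡⟨ cong₂ Q._*_ nx≡e ny≡e' ⟨
      normQ K x Q.* normQ K y   ≡⟨ normQ-mul K x y ⟨
      normQ K (mulQ K x y)      ≡⟨ cong (normQ K) xy≡1 ⟩
      normQ K oneQ              ≡⟨ normQ-one K ⟩
      ι (+ 1)                   ∎)

module SquareFreeIntegrality where

  open import Data.Nat.Divisibility using (_∣_; divides; ∣-trans)
  open import Data.Nat.Coprimality as Coprimality using (Coprime; coprime-divisor)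
  open Embedding

  coprime-squareˡ : ∀ {m n} → Coprime m n → Coprime (m ℕ.* m) n
  coprime-squareˡ m⊥n (i∣m² , i∣n) =
    m⊥n (coprime-divisor (λ (j∣i , j∣m) → m⊥n (j∣m , ∣-trans j∣i i∣n)) i∣m² , i∣n)

  coprime-squares : ∀ {m n} → Coprime m n → Coprime (m ℕ.* m) (n ℕ.* n)
  coprime-squares m⊥n = Coprimality.sym (coprime-squareˡ (Coprimality.sym (coprime-squareˡ m⊥n)))

  integral-of-squarefree-*-square : ∀ M → SquareFree M → (q : ℚ) (k : ℤ) →
    ι (+ M) Q.* (q Q.* q) ≡ ι k → Σ ℤ λ Y → q ≡ ι Y
  integral-of-squarefree-*-square M sqfree q@(Q.mkℚ n d n⊥d) k Mq²≡k =
    n , trans (sym (QP.↥p/↧p≡p q)) (cong (λ d → n / suc d) d≡0)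
    where
    unnormalised : mkℚᵘ (+ M) 0 U.* (mkℚᵘ n d U.* mkℚᵘ n d) U.≃ mkℚᵘ k 0
    unnormalised = UP.≃-trans (UP.*-congʳ {mkℚᵘ n d U.* mkℚᵘ n d} (UP.≃-sym (QP.toℚᵘ-fromℚᵘ (mkℚᵘ (+ M) 0))))
      (UP.≃-trans (UP.≃-sym (UP.≃-trans (QP.toℚᵘ-homo-* (ι (+ M)) (q Q.* q))
        (UP.*-congˡ {toℚᵘ (ι (+ M))} (QP.toℚᵘ-homo-* q q))))
      (UP.≃-trans (QP.toℚᵘ-cong Mq²≡k) (QP.toℚᵘ-fromℚᵘ (mkℚᵘ k 0))))
    cross : ℤ.∣ (+ M ℤ.* (n ℤ.* n)) ℤ.* + 1 ∣ ≡ ℤ.∣ k ℤ.* + suc ((d ℕ.+ d ℕ.* suc d) ℕ.+ 0) ∣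
    cross with unnormalised
    ... | *≡* p = cong ℤ.∣_∣ p
    Mn²≡kd² : M ℕ.* (ℤ.∣ n ∣ ℕ.* ℤ.∣ n ∣) ℕ.* 1 ≡ ℤ.∣ k ∣ ℕ.* (suc d ℕ.* suc d)
    Mn²≡kd² = begin
      M ℕ.* (ℤ.∣ n ∣ ℕ.* ℤ.∣ n ∣) ℕ.* 1            ≡⟨ cong (λ z → M ℕ.* z ℕ.* 1) (ℤP.abs-* n n) ⟨
      M ℕ.* ℤ.∣ n ℤ.* n ∣ ℕ.* 1                     ≡⟨ cong (ℕ._* 1) (ℤP.abs-* (+ M) (n ℤ.* n)) ⟨
      ℤ.∣ + M ℤ.* (n ℤ.* n) ∣ ℕ.* 1                 ≡⟨ ℤP.abs-* (+ M ℤ.* (n ℤ.* n)) (+ 1) ⟨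
      ℤ.∣ (+ M ℤ.* (n ℤ.* n)) ℤ.* + 1 ∣             ≡⟨ cross ⟩
      ℤ.∣ k ℤ.* + suc ((d ℕ.+ d ℕ.* suc d) ℕ.+ 0) ∣  ≡⟨ ℤP.abs-* k _ ⟩
      ℤ.∣ k ∣ ℕ.* suc ((d ℕ.+ d ℕ.* suc d) ℕ.+ 0)    ≡⟨ cong (λ z → ℤ.∣ k ∣ ℕ.* suc z) (ℕP.+-identityʳ _) ⟩
      ℤ.∣ k ∣ ℕ.* (suc d ℕ.* suc d)                  ∎
      where open ≡-Reasoning
    d²∣n²M : (suc d ℕ.* suc d) ∣ ((ℤ.∣ n ∣ ℕ.* ℤ.∣ n ∣) ℕ.* M)
    d²∣n²M = divides ℤ.∣ k ∣ (trans (ℕP.*-comm (ℤ.∣ n ∣ ℕ.* ℤ.∣ n ∣) M)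
                                    (trans (sym (ℕP.*-identityʳ _)) Mn²≡kd²))
    d≡0 : d ≡ 0
    d≡0 = ℕP.suc-injective (sqfree (suc d)
            (coprime-divisor (coprime-squares (Coprimality.sym (Coprimality.recompute n⊥d))) d²∣n²M))

module HalfIntegralUnits where

  open Embedding
  open CommonDenominator
  open Units
  open SquareFreeIntegrality
  open IntegerInequalities using (Norm≡±4; Pell±4; norm≡±4⇒pell±4; 0<coordinates-of->1)
  open ℚSolver.+-*-Solver

  halves : ℤ → ℤ → QF
  halves A B = scaled A B ½

  0<½ : 0ℚ Q.< ½
  0<½ = Q.*<* (+<+ (s≤s z≤n))

  private
    quarter : ∀ z → ι (+ 4 ℤ.* z) Q.* (½ Q.* ½) ≡ ι z
    quarter z = trans (cong (Q._* (½ Q.* ½)) (ι-homo-* (+ 4) z))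
      (solve 1 (λ a → (con (ι (+ 4)) :* a) :* (con ½ :* con ½) := a) refl (ι z))

  halves-norm : ∀ K A B e → A ℤ.* A ℤ.- + K ℤ.* (B ℤ.* B) ≡ + 4 ℤ.* e → normQ K (halves A B) ≡ ι e
  halves-norm K A B e norm = trans (scaled-norm K A B ½) (trans (cong (λ z → ι z Q.* (½ Q.* ½)) norm) (quarter e))

  halves-trace : ∀ K A B → traceQ K (halves A B) ≡ ι A
  halves-trace K A B = trans (scaled-trace K A B ½) (trans (cong (Q._* ½) (ι-homo-+ A A))
    (solve 1 (λ a → (a :+ a) :* con ½ := a) refl (ι A)))

  private
    halves-isUnit : ∀ K A B e → A ℤ.* A ℤ.- + K ℤ.* (B ℤ.* B) ≡ + 4 ℤ.* e → e ℤ.* e ≡ + 1 →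
      IsUnit K (halves A B)
    halves-isUnit K A B e norm =
      isUnit-of-trace-norm K (halves A B) A e (halves-trace K A B) (halves-norm K A B e norm)

  halves-unit-norm+1 : ∀ K A B → A ℤ.* A ≡ + K ℤ.* (B ℤ.* B) ℤ.+ + 4 →
    IsUnit K (halves A B) × normQ K (halves A B) ≡ 1ℚ
  halves-unit-norm+1 K A B pell = halves-isUnit K A B (+ 1) norm refl , halves-norm K A B (+ 1) norm
    where
    cancel : ∀ n → n ℤ.+ + 4 ℤ.- n ≡ + 4 ℤ.* + 1
    cancel = ℤSolver.solve-∀
    norm : A ℤ.* A ℤ.- + K ℤ.* (B ℤ.* B) ≡ + 4 ℤ.* + 1
    norm = trans (cong (ℤ._- + K ℤ.* (B ℤ.* B)) pell) (cancel (+ K ℤ.* (B ℤ.* B)))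

  halves-unit-norm-1 : ∀ K A B → A ℤ.* A ℤ.+ + 4 ≡ + K ℤ.* (B ℤ.* B) →
    IsUnit K (halves A B) × normQ K (halves A B) ≡ Q.- 1ℚ
  halves-unit-norm-1 K A B pell = halves-isUnit K A B -[1+ 0 ] norm refl , halves-norm K A B -[1+ 0 ] norm
    where
    cancel : ∀ a → a ℤ.- (a ℤ.+ + 4) ≡ + 4 ℤ.* -[1+ 0 ]
    cancel = ℤSolver.solve-∀
    norm : A ℤ.* A ℤ.- + K ℤ.* (B ℤ.* B) ≡ + 4 ℤ.* -[1+ 0 ]
    norm = trans (cong (λ n → A ℤ.* A ℤ.- n) (sym pell)) (cancel (A ℤ.* A))

  module _ (K : ℕ) (A B C E : ℤ) where

    GtQ-halves⇒Posℤ : GtQ K (halves A B) (halves C E) → Posℤ (+ K) (A ℤ.- C) (B ℤ.- E)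
    GtQ-halves⇒Posℤ = GtQ-scaled⇒Posℤ ½ 0<½ K A B C E

    Posℤ⇒GtQ-halves : Posℤ (+ K) (A ℤ.- C) (B ℤ.- E) → GtQ K (halves A B) (halves C E)
    Posℤ⇒GtQ-halves = Posℤ⇒GtQ-scaled ½ 0<½ K A B C E

  halves>1⇒Posℤ : ∀ K A B → GtQ K (halves A B) oneQ → Posℤ (+ K) (A ℤ.- + 2) B
  halves>1⇒Posℤ K A B g = subst (Posℤ (+ K) (A ℤ.- + 2)) (ℤP.+-identityʳ B) (GtQ-halves⇒Posℤ K A B (+ 2) 0ℤ g)

  Posℤ⇒halves>1 : ∀ K A B → Posℤ (+ K) (A ℤ.- + 2) B → GtQ K (halves A B) oneQ
  Posℤ⇒halves>1 K A B p = Posℤ⇒GtQ-halves K A B (+ 2) 0ℤ (subst (Posℤ (+ K) (A ℤ.- + 2)) (sym (ℤP.+-identityʳ B)) p)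

  -- 2 re ε = tr ε is integral, and M (2 im ε)² = (tr ε)² − 4 N ε then forces 2 im ε to be integral.
  halves-form : ∀ M → SquareFree M → ∀ ε → IsUnit M ε →
    Σ ℤ λ X → Σ ℤ λ Y → ε ≡ halves X Y × Norm≡±4 (+ M) X Y
  halves-form M sqfree ε@(mk a b) ε-unit@(((X , 2a≡X) , _) , _) = X , Y , ε≡ , norm (proj₂ (proj₂ norm≡±1))
    where
    norm≡±1 : Σ ℤ λ e → normQ M ε ≡ ι e × (e ≡ + 1 ⊎ e ≡ -[1+ 0 ])
    norm≡±1 = unit-norm≡±1 M ε ε-unit
    e : ℤ
    e = proj₁ norm≡±1
    Nε≡e : normQ M ε ≡ ι e
    Nε≡e = proj₁ (proj₂ norm≡±1)
    d : ℚ
    d = ι (+ M)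
    M[2b]²≡X²-4e : d Q.* ((b Q.+ b) Q.* (b Q.+ b)) ≡ ι (X ℤ.* X ℤ.- + 4 ℤ.* e)
    M[2b]²≡X²-4e = begin
      d Q.* ((b Q.+ b) Q.* (b Q.+ b))
        ≡⟨ solve 3 (λ a b d → d :* ((b :+ b) :* (b :+ b))
                              := (a :+ a) :* (a :+ a) :- con (ι (+ 4)) :* (a :* a :- d :* (b :* b))) refl a b d ⟩
      (a Q.+ a) Q.* (a Q.+ a) Q.- ι (+ 4) Q.* normQ M ε  ≡⟨ cong₂ (λ p q → p Q.* p Q.- ι (+ 4) Q.* q) 2a≡X Nε≡e ⟩
      ι X Q.* ι X Q.- ι (+ 4) Q.* ι e                     ≡⟨ cong₂ Q._-_ (ι-homo-* X X) (ι-homo-* (+ 4) e) ⟨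
      ι (X ℤ.* X) Q.- ι (+ 4 ℤ.* e)                       ≡⟨ ι-homo-− (X ℤ.* X) (+ 4 ℤ.* e) ⟨
      ι (X ℤ.* X ℤ.- + 4 ℤ.* e)                           ∎
      where open ≡-Reasoning
    2b-integral : Σ ℤ λ Y → b Q.+ b ≡ ι Y
    2b-integral = integral-of-squarefree-*-square M sqfree (b Q.+ b) (X ℤ.* X ℤ.- + 4 ℤ.* e) M[2b]²≡X²-4e
    Y : ℤ
    Y = proj₁ 2b-integral
    half-of-double : ∀ a → a ≡ (a Q.+ a) Q.* ½
    half-of-double a = solve 1 (λ a → a := (a :+ a) :* con ½) refl a
    ε≡ : ε ≡ halves X Y
    ε≡ = cong₂ mk (trans (half-of-double a) (cong (Q._* ½) 2a≡X))
                  (trans (half-of-double b) (cong (Q._* ½) (proj₂ 2b-integral)))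
    X²-MY²≡4e : X ℤ.* X ℤ.- + M ℤ.* (Y ℤ.* Y) ≡ + 4 ℤ.* e
    X²-MY²≡4e = PositiveScale.*c-injective (½ Q.* ½) (Q.*<* (+<+ (s≤s z≤n)))
      (trans (sym (scaled-norm M X Y ½)) (trans (cong (normQ M) (sym ε≡)) (trans Nε≡e (sym (quarter e)))))
    norm : e ≡ + 1 ⊎ e ≡ -[1+ 0 ] → Norm≡±4 (+ M) X Y
    norm (inj₁ refl) = inj₁ X²-MY²≡4e
    norm (inj₂ refl) = inj₂ X²-MY²≡4e

  record PositiveHalves (M : ℕ) (ε : QF) : Set where
    field
      x y : ℕ
      0<x : 0 ℕ.< x
      0<y : 0 ℕ.< y
      ε≡ : ε ≡ halves (+ x) (+ y)
      pell : Pell±4 (+ M) (+ x) (+ y)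

  unit>1-positiveHalves : ∀ M → SquareFree M → ∀ ε → IsUnit M ε → GtQ M ε oneQ → PositiveHalves M ε
  unit>1-positiveHalves M sqfree ε ε-unit ε>1 = from-form (halves-form M sqfree ε ε-unit)
    where
    positive : ∀ {X Y} → 0ℤ ℤ.< X × 0ℤ ℤ.< Y → ε ≡ halves X Y → Norm≡±4 (+ M) X Y → PositiveHalves M ε
    positive (+<+ {n = suc x} _ , +<+ {n = suc y} _) ε≡ norm = record
      { x = suc x ; y = suc y ; 0<x = s≤s z≤n ; 0<y = s≤s z≤n ; ε≡ = ε≡
      ; pell = norm≡±4⇒pell±4 (+ M) (+ suc x) (+ suc y) norm }
    from-form : (Σ ℤ λ X → Σ ℤ λ Y → ε ≡ halves X Y × Norm≡±4 (+ M) X Y) → PositiveHalves M ε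
    from-form (X , Y , ε≡ , norm) = positive (0<coordinates-of->1 (+ M) X Y (+≤+ z≤n) norm
      (halves>1⇒Posℤ M X Y (subst (λ u → GtQ M u oneQ) ε≡ ε>1))) ε≡ norm

-- u = (s + √(s² + 4))/2 written in ℚ(√K): from K ρ² = s²(s² + 4) we get √(s² + 4) = ρ√K / s,
-- so u = (s² + ρ√K) · c with c = 1/(2s).
module SquareRootUnit (s : ℕ) .{{_ : NonZero s}} (K : ℕ) (ρ : ℤ)
                      (Kρ²≡ : + K ℤ.* (ρ ℤ.* ρ) ≡ + s ℤ.* + s ℤ.* (+ s ℤ.* + s ℤ.+ + 4)) where

  open import Data.Integer using (_+_; _*_; _-_)
  open Embedding
  open CommonDenominator
  open Units
  open HalfIntegralUnits using (halves)
  open IntegerInequalities using (Posℤ[s²-2s])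
  open ℚSolver.+-*-Solver

  S : ℤ
  S = + s

  c : ℚ
  c = (+ 1 / s) Q.* ½

  u : QF
  u = scaled (S * S) ρ c

  0<c : 0ℚ Q.< c
  0<c = QP.positive⁻¹ c {{QP.pos*pos⇒pos (+ 1 / s) {{QP.normalize-pos 1 s}} ½}}

  S*c≡½ : ι S Q.* c ≡ ½
  S*c≡½ = trans (sym (QP.*-assoc (ι S) (+ 1 / s) ½)) (trans (cong (Q._* ½) (S*1/S≡1 s)) (QP.*-identityˡ ½))
    where
    S*1/S≡1 : ∀ s .{{_ : NonZero s}} → ι (+ s) Q.* (+ 1 / s) ≡ 1ℚ
    S*1/S≡1 (suc n) = QP.toℚᵘ-injective (UP.≃-trans (QP.toℚᵘ-homo-* (ι (+ suc n)) (+ 1 / suc n))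
      (UP.≃-trans (UP.*-cong (QP.toℚᵘ-fromℚᵘ (mkℚᵘ (+ suc n) 0)) (QP.toℚᵘ-fromℚᵘ (mkℚᵘ (+ 1) n)))
        (*≡* (trans (ℤP.*-identityʳ _) (trans (ℤP.*-identityʳ _)
          (trans (cong (λ m → + suc m) (sym (ℕP.+-identityʳ n))) (sym (ℤP.*-identityˡ _))))))))

  *S*c≡*½ : ∀ A → ι (A * S) Q.* c ≡ ι A Q.* ½
  *S*c≡*½ A = trans (cong (Q._* c) (ι-homo-* A S)) (trans (QP.*-assoc (ι A) (ι S) c) (cong (ι A Q.*_) S*c≡½))

  private
    *2S²*c²≡*½ : ∀ A → ι (A * (+ 2 * (S * S))) Q.* (c Q.* c) ≡ ι A Q.* ½
    *2S²*c²≡*½ A = begin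
      ι (A * (+ 2 * (S * S))) Q.* (c Q.* c)
        ≡⟨ cong (Q._* (c Q.* c)) (trans (ι-homo-* A _)
             (cong (ι A Q.*_) (trans (ι-homo-* (+ 2) (S * S)) (cong (ι (+ 2) Q.*_) (ι-homo-* S S))))) ⟩
      ι A Q.* (ι (+ 2) Q.* (ι S Q.* ι S)) Q.* (c Q.* c)
        ≡⟨ solve 4 (λ a t s c → (a :* (t :* (s :* s))) :* (c :* c) := a :* (t :* ((s :* c) :* (s :* c))))
             refl (ι A) (ι (+ 2)) (ι S) c ⟩
      ι A Q.* (ι (+ 2) Q.* ((ι S Q.* c) Q.* (ι S Q.* c)))
        ≡⟨ cong (λ h → ι A Q.* (ι (+ 2) Q.* (h Q.* h))) S*c≡½ ⟩
      ι A Q.* ½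
        ∎
      where open ≡-Reasoning

  u-norm : normQ K u ≡ Q.- 1ℚ
  u-norm = begin
    normQ K u                                          ≡⟨ scaled-norm K (S * S) ρ c ⟩
    ι (S * S * (S * S) - + K * (ρ * ρ)) Q.* (c Q.* c)  ≡⟨ cong (λ n → ι (S * S * (S * S) - n) Q.* (c Q.* c)) Kρ²≡ ⟩
    ι (S * S * (S * S) - S * S * (S * S + + 4)) Q.* (c Q.* c)  ≡⟨ cong (λ n → ι n Q.* (c Q.* c)) (collect S) ⟩
    ι (-[1+ 3 ] * S * S) Q.* (c Q.* c)
      ≡⟨ cong (Q._* (c Q.* c)) (trans (ι-homo-* (-[1+ 3 ] * S) S) (cong (Q._* ι S) (ι-homo-* -[1+ 3 ] S))) ⟩
    ι -[1+ 3 ] Q.* ι S Q.* ι S Q.* (c Q.* c)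
      ≡⟨ solve 3 (λ f s c → (f :* s :* s) :* (c :* c) := f :* ((s :* c) :* (s :* c))) refl (ι -[1+ 3 ]) (ι S) c ⟩
    ι -[1+ 3 ] Q.* ((ι S Q.* c) Q.* (ι S Q.* c))       ≡⟨ cong (λ h → ι -[1+ 3 ] Q.* (h Q.* h)) S*c≡½ ⟩
    Q.- 1ℚ                                             ∎
    where
    open ≡-Reasoning
    collect : ∀ S → S * S * (S * S) - S * S * (S * S + + 4) ≡ -[1+ 3 ] * S * S
    collect = ℤSolver.solve-∀

  u-trace : traceQ K u ≡ ι S
  u-trace = begin
    traceQ K u                          ≡⟨ scaled-trace K (S * S) ρ c ⟩
    ι (S * S + S * S) Q.* c
      ≡⟨ cong (Q._* c) (trans (ι-homo-+ (S * S) (S * S)) (cong₂ Q._+_ (ι-homo-* S S) (ι-homo-* S S))) ⟩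
    (ι S Q.* ι S Q.+ ι S Q.* ι S) Q.* c
      ≡⟨ solve 2 (λ s c → (s :* s :+ s :* s) :* c := s :* (con (ι (+ 2)) :* (s :* c))) refl (ι S) c ⟩
    ι S Q.* (ι (+ 2) Q.* (ι S Q.* c))   ≡⟨ cong (λ h → ι S Q.* (ι (+ 2) Q.* h)) S*c≡½ ⟩
    ι S Q.* 1ℚ                          ≡⟨ QP.*-identityʳ (ι S) ⟩
    ι S                                 ∎
    where open ≡-Reasoning

  u-isUnit : IsUnit K u
  u-isUnit = isUnit-of-trace-norm K u S -[1+ 0 ] u-trace u-norm refl

  u²≡ : sqQ K u ≡ halves (S * S + + 2) ρ
  u²≡ = trans (scaled-mul K (S * S) ρ (S * S) ρ c) (cong₂ mk
    (trans (cong (λ n → ι (S * S * (S * S) + n) Q.* (c Q.* c)) Kρ²≡)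
      (trans (cong (λ n → ι n Q.* (c Q.* c)) (collect-re S)) (*2S²*c²≡*½ (S * S + + 2))))
    (trans (cong (λ n → ι n Q.* (c Q.* c)) (collect-im S ρ)) (*2S²*c²≡*½ ρ)))
    where
    collect-re : ∀ S → S * S * (S * S) + S * S * (S * S + + 4) ≡ (S * S + + 2) * (+ 2 * (S * S))
    collect-re = ℤSolver.solve-∀
    collect-im : ∀ S ρ → S * S * ρ + ρ * (S * S) ≡ ρ * (+ 2 * (S * S))
    collect-im = ℤSolver.solve-∀

  u>1 : 0ℤ ℤ.< ρ → GtQ K u oneQ
  u>1 0<ρ = subst (GtQ K u) (sym 1≡) (Posℤ⇒GtQ-scaled c 0<c K (S * S) ρ (+ 2 * S) 0ℤ
    (subst (Posℤ (+ K) (S * S - + 2 * S)) (sym (ℤP.+-identityʳ ρ)) (Posℤ[s²-2s] s (+ K) ρ 0<ρ Kρ²≡)))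
    where
    1≡ : oneQ ≡ scaled (+ 2 * S) 0ℤ c
    1≡ = cong₂ mk (sym (begin
      ι (+ 2 * S) Q.* c         ≡⟨ cong (Q._* c) (trans (ι-homo-* (+ 2) S) (QP.*-comm (ι (+ 2)) (ι S))) ⟩
      ι S Q.* ι (+ 2) Q.* c     ≡⟨ solve 3 (λ s t c → s :* t :* c := s :* c :* t) refl (ι S) (ι (+ 2)) c ⟩
      ι S Q.* c Q.* ι (+ 2)     ≡⟨ cong (Q._* ι (+ 2)) S*c≡½ ⟩
      1ℚ                        ∎)) (sym (QP.*-zeroˡ c))
      where open ≡-Reasoning

module SquareRootOfE₁ where

  open Embedding
  open HalfIntegralUnits using (halves)
  open ℚSolver.+-*-Solver
  open import Data.Nat using (_+_; _*_; _∸_)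

  IsNormMinusOneRoot : ℕ → QF → QF → Set
  IsNormMinusOneRoot D v u = IsUnit D u × normQ D u ≡ Q.- 1ℚ × sqQ D u ≡ v

  E₁≡halves : ∀ t → E₁ t ≡ halves (+ t) (+ 1)
  E₁≡halves t = cong₂ mk (ι/2≡ι*½ (+ t)) (sym (QP.*-identityˡ ½))

  discriminant : ∀ s → (s * s + 2) * (s * s + 2) ∸ 4 ≡ s * s * (s * s + 4)
  discriminant s = trans (cong (_∸ 4) (expand (s * s))) (ℕP.m+n∸n≡m _ 4)
    where
    open import Data.Nat.Tactic.RingSolver using () renaming (solve-∀ to solveℕ-∀)
    expand : ∀ m → (m + 2) * (m + 2) ≡ m * (m + 4) + 4
    expand = solveℕ-∀

  module _ (s : ℕ) .{{_ : NonZero s}} where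

    private
      t : ℕ
      t = s * s + 2

      D·1²≡ : + (t * t ∸ 4) ℤ.* (+ 1 ℤ.* + 1) ≡ + s ℤ.* + s ℤ.* (+ s ℤ.* + s ℤ.+ + 4)
      D·1²≡ = begin
        + (t * t ∸ 4) ℤ.* (+ 1 ℤ.* + 1)             ≡⟨ ℤP.*-identityʳ _ ⟩
        + (t * t ∸ 4)                               ≡⟨ cong +_ (discriminant s) ⟩
        + (s * s * (s * s + 4))                     ≡⟨ ℤP.pos-* (s * s) _ ⟩
        + (s * s) ℤ.* + (s * s + 4)
          ≡⟨ cong₂ ℤ._*_ (ℤP.pos-* s s) (trans (ℤP.pos-+ (s * s) 4) (cong (ℤ._+ + 4) (ℤP.pos-* s s))) ⟩
        + s ℤ.* + s ℤ.* (+ s ℤ.* + s ℤ.+ + 4)       ∎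
        where open ≡-Reasoning

    open SquareRootUnit s (t * t ∸ 4) (+ 1) D·1²≡ public using (u; u-isUnit; u-norm)
    open SquareRootUnit s (t * t ∸ 4) (+ 1) D·1²≡ using (c; *S*c≡*½; u²≡)

    u≡ : mk (+ s / 2) ((+ 1 / s) Q.* ½) ≡ u
    u≡ = cong₂ mk (trans (ι/2≡ι*½ (+ s)) (sym (*S*c≡*½ (+ s)))) (sym (QP.*-identityˡ c))

    u²≡E₁ : sqQ (t * t ∸ 4) u ≡ E₁ t
    u²≡E₁ = trans u²≡ (trans (cong (λ n → halves n (+ 1)) (sym t≡)) (sym (E₁≡halves t)))
      where
      t≡ : + t ≡ + s ℤ.* + s ℤ.+ + 2
      t≡ = trans (ℤP.pos-+ (s * s) 2) (cong (ℤ._+ + 2) (ℤP.pos-* s s))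

  trace²≡2[re-sq+norm] : ∀ D x → traceQ D x Q.* traceQ D x ≡ (re (sqQ D x) Q.+ normQ D x) Q.* ι (+ 2)
  trace²≡2[re-sq+norm] D (mk a b) =
    solve 3 (λ a b d → (a :+ a) :* (a :+ a) := (a :* a :+ d :* (b :* b) :+ (a :* a :- d :* (b :* b))) :* con (ι (+ 2)))
      refl a b (ι (+ D))

  t∸2-square-of-E₁-root : ∀ t → 3 ℕ.≤ t → ∃ (IsNormMinusOneRoot (t * t ∸ 4) (E₁ t)) →
    ∃ λ t' → 1 ℕ.≤ t' × t ≡ t' * t' + 2
  t∸2-square-of-E₁-root (suc (suc m)) (s≤s (s≤s 1≤m)) (u , (((z , trace≡z) , _) , _) , Nu≡-1 , u²≡E₁) =
    root ℤ.∣ z ∣ (trans (sym (ℤP.abs-* z z)) (cong ℤ.∣_∣ z²≡m))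
    where
    D : ℕ
    D = suc (suc m) * suc (suc m) ∸ 4
    z²≡m : z ℤ.* z ≡ + m
    z²≡m = ι-injective (begin
      ι (z ℤ.* z)                                           ≡⟨ ι-homo-* z z ⟩
      ι z Q.* ι z                                           ≡⟨ cong₂ Q._*_ trace≡z trace≡z ⟨
      traceQ D u Q.* traceQ D u                             ≡⟨ trace²≡2[re-sq+norm] D u ⟩
      (re (sqQ D u) Q.+ normQ D u) Q.* ι (+ 2)
        ≡⟨ cong₂ (λ p n → (p Q.+ n) Q.* ι (+ 2)) (trans (cong re u²≡E₁) (ι/2≡ι*½ (+ suc (suc m)))) Nu≡-1 ⟩
      (ι (+ suc (suc m)) Q.* ½ Q.+ Q.- 1ℚ) Q.* ι (+ 2)
        ≡⟨ solve 1 (λ t → (t :* con ½ :+ con (Q.- 1ℚ)) :* con (ι (+ 2)) := t :- con (ι (+ 2))) refl (ι (+ suc (suc m))) ⟩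
      ι (+ suc (suc m)) Q.- ι (+ 2)                         ≡⟨ ι-homo-− (+ suc (suc m)) (+ 2) ⟨
      ι (+ m)                                               ∎)
      where open ≡-Reasoning
    root : ∀ n → n * n ≡ m → ∃ λ t' → 1 ℕ.≤ t' × suc (suc m) ≡ t' * t' + 2
    root zero refl = contradiction 1≤m λ ()
    root (suc n) n²≡m = suc n , s≤s z≤n , trans (cong (λ k → suc (suc k)) (sym n²≡m)) (ℕP.+-comm 2 (suc n * suc n))

  E₁-root⇔t∸2-square : ∀ t → 3 ℕ.≤ t →
    ∃ (IsNormMinusOneRoot (t * t ∸ 4) (E₁ t)) ⇔ (∃ λ t' → 1 ℕ.≤ t' × t ≡ t' * t' + 2)
  E₁-root⇔t∸2-square t 3≤t = mk⇔ (t∸2-square-of-E₁-root t 3≤t)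
    λ { (s@(suc _) , _ , refl) → u s , u-isUnit s , u-norm s , u²≡E₁ s }

  E₁≡square : ∀ t (t' : ℕ) .{{_ : NonZero t'}} → t ≡ t' * t' + 2 →
    E₁ t ≡ sqQ (t * t ∸ 4) (mk (+ t' / 2) ((+ 1 / t') Q.* ½))
  E₁≡square t t' refl = trans (sym (u²≡E₁ t')) (cong (sqQ (t * t ∸ 4)) (sym (u≡ t')))

module MinimalSolution
  (t M r : ℕ) (3≤t : 3 ℕ.≤ t) (2≤M : 2 ℕ.≤ M) (sqfree : SquareFree M) (1≤r : 1 ℕ.≤ r)
  (t-pell : t ℕ.* t ≡ M ℕ.* (r ℕ.* r) ℕ.+ 4)
  (minimal : ∀ (t₁ r₁ : ℕ) → 1 ℕ.≤ t₁ → t₁ ℕ.< t → 1 ℕ.≤ r₁ →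
             ¬ (t₁ ℕ.* t₁ ≡ M ℕ.* (r₁ ℕ.* r₁) ℕ.+ 4))
  (ε : QF) (ε-fundamental : IsFundamentalUnit M ε) where

  open import Data.Integer using (_+_; _*_; _-_; _≤_; _<_)
  open Embedding
  open CommonDenominator
  open IntegerInequalities
  open Parity
  open HalfIntegralUnits

  private
    +[a*a] : ∀ a → + (a ℕ.* a) ≡ + a * + a
    +[a*a] a = ℤP.pos-* a a

    +[M*[b*b]] : ∀ b → + (M ℕ.* (b ℕ.* b)) ≡ + M * (+ b * + b)
    +[M*[b*b]] b = trans (ℤP.pos-* M (b ℕ.* b)) (cong (+ M *_) (ℤP.pos-* b b))

    +[M*[b*b]+c] : ∀ b c → + (M ℕ.* (b ℕ.* b) ℕ.+ c) ≡ + M * (+ b * + b) + + c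
    +[M*[b*b]+c] b c = trans (ℤP.pos-+ (M ℕ.* (b ℕ.* b)) c) (cong (_+ + c) (+[M*[b*b]] b))

    +[a*a+4] : ∀ a → + (a ℕ.* a ℕ.+ 4) ≡ + a * + a + + 4
    +[a*a+4] a = trans (ℤP.pos-+ (a ℕ.* a) 4) (cong (_+ + 4) (+[a*a] a))

  pellℕ⇒ℤ : ∀ a b c → a ℕ.* a ≡ M ℕ.* (b ℕ.* b) ℕ.+ c → + a * + a ≡ + M * (+ b * + b) + + c
  pellℕ⇒ℤ a b c e = trans (sym (+[a*a] a)) (trans (cong +_ e) (+[M*[b*b]+c] b c))

  pellℤ⇒ℕ : ∀ a b c → + a * + a ≡ + M * (+ b * + b) + + c → a ℕ.* a ≡ M ℕ.* (b ℕ.* b) ℕ.+ c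
  pellℤ⇒ℕ a b c e = ℤP.+-injective (trans (+[a*a] a) (trans e (sym (+[M*[b*b]+c] b c))))

  pell⁻ℤ⇒ℕ : ∀ a b → + a * + a + + 4 ≡ + M * (+ b * + b) → a ℕ.* a ℕ.+ 4 ≡ M ℕ.* (b ℕ.* b)
  pell⁻ℤ⇒ℕ a b e = ℤP.+-injective (trans (+[a*a+4] a) (trans e (sym (+[M*[b*b]] b))))

  T R : ℤ
  T = + t
  R = + r

  private
    0<M : 0ℤ < + M
    0<M = +<+ (ℕP.≤-trans (s≤s z≤n) 2≤M)

    0≤M : Nonneg (+ M)
    0≤M = nonneg-ℕ M

    0<R : 0ℤ < R
    0<R = +<+ 1≤r

  T-pell : T * T ≡ + M * (R * R) + + 4
  T-pell = pellℕ⇒ℤ t r 4 t-pell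

  η : QF
  η = halves T R

  η≡ : mk (+ t / 2) (+ r / 2) ≡ η
  η≡ = cong₂ mk (ι/2≡ι*½ T) (ι/2≡ι*½ R)

  η-unit : IsUnit M η
  η-unit = proj₁ (halves-unit-norm+1 M T R T-pell)

  η-norm : normQ M η ≡ 1ℚ
  η-norm = proj₂ (halves-unit-norm+1 M T R T-pell)

  η>1 : GtQ M η oneQ
  η>1 = Posℤ⇒halves>1 M T R (Posℤ[2≤X] (+ M) T R (+≤+ (ℕP.≤-trans (ℕP.n≤1+n 2) 3≤t)) 0<R)

  fundamental : ∀ u → IsUnit M u → GtQ M u oneQ → u ≡ ε ⊎ GtQ M u ε
  fundamental = proj₂ (proj₂ ε-fundamental)

  open PositiveHalves (unit>1-positiveHalves M sqfree ε (proj₁ ε-fundamental) (proj₁ (proj₂ ε-fundamental)))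

  X Y : ℤ
  X = + x
  Y = + y

  open MinimalNormFour {+ M} {T} {R} 0<M (+≤+ 3≤t) (nonneg-ℕ r) T-pell

  η>ε⇒Posℤ : GtQ M η ε → Posℤ (+ M) (T - X) (R - Y)
  η>ε⇒Posℤ η>ε = GtQ-halves⇒Posℤ M T R X Y (subst (GtQ M η) ε≡ η>ε)

  Conclusion : Set
  Conclusion = (IsSquareℕ (t ℕ.∸ 2) → mk (+ t / 2) (+ r / 2) ≡ sqQ M ε)
             × (¬ IsSquareℕ (t ℕ.∸ 2) → mk (+ t / 2) (+ r / 2) ≡ ε)

  module NormPlusOne (X-pell : X * X ≡ + M * (Y * Y) + + 4) where

    t≤x : t ℕ.≤ x
    t≤x = ℕP.≮⇒≥ (λ x<t → minimal x y 0<x x<t 0<y (pellℤ⇒ℕ x y 4 X-pell))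

    ¬η>ε : ¬ GtQ M η ε
    ¬η>ε η>ε = ¬Posℤ-nonPos (+ M) (T - X) (R - Y) 0≤M (η>ε⇒Posℤ η>ε)
      (ℤP.i≤j⇒i-j≤0 (+≤+ t≤x)) (ℤP.i≤j⇒i-j≤0 (r≤y-of-t≤x X Y (nonneg-ℕ y) X-pell (+≤+ t≤x)))

    η≡ε : η ≡ ε
    η≡ε = [ id , ⊥-elim ∘ ¬η>ε ]′ (fundamental η η-unit η>1)

    ¬t∸2-square : ¬ IsSquareℕ (t ℕ.∸ 2)
    ¬t∸2-square (zero , t∸2≡0) = ℕP.<⇒≱ 3≤t (ℕP.m∸n≡0⇒m≤n t∸2≡0)
    ¬t∸2-square (suc n , t∸2≡s²) =
      ¬root-below-η (suc n) (trans (sym (ℕP.m∸n+n≡m (ℕP.≤-trans (ℕP.n≤1+n 2) 3≤t))) (cong (ℕ._+ 2) t∸2≡s²))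
      where
      -- Here η = u², so u ≥ ε = η is impossible: over the common denominator 2s,
      -- both coordinates of u − η are ≤ 0.
      ¬root-below-η : ∀ s .{{_ : NonZero s}} → t ≡ s ℕ.* s ℕ.+ 2 → ⊥
      ¬root-below-η s t≡ = from-fundamental (fundamental u u-isUnit (u>1 0<R))
        where
        S : ℤ
        S = + s
        T≡ : T ≡ S * S + + 2
        T≡ = trans (cong +_ t≡) (trans (ℤP.pos-+ (s ℕ.* s) 2) (cong (_+ + 2) (ℤP.pos-* s s)))
        MR²≡ : + M * (R * R) ≡ S * S * (S * S + + 4)
        MR²≡ = trans (≡+4⇒-4≡ (T * T) (+ M * (R * R)) T-pell) (trans (cong (λ z → z * z - + 4) T≡) (factor S))
          where
          factor : ∀ S → (S * S + + 2) * (S * S + + 2) - + 4 ≡ S * S * (S * S + + 4)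
          factor = ℤSolver.solve-∀
        open SquareRootUnit s M R MR²≡ hiding (S)
        ε≡scaled : ε ≡ scaled (T * S) (R * S) c
        ε≡scaled = trans (sym η≡ε) (cong₂ mk (sym (*S*c≡*½ T)) (sym (*S*c≡*½ R)))
        S*S≤T*S : S * S ≤ T * S
        S*S≤T*S = ℤP.*-monoʳ-≤-nonNeg S {{ℤ.nonNegative (nonneg-ℕ s)}}
          (+≤+ (subst (s ℕ.≤_) (sym t≡) (ℕP.≤-trans (ℕP.m≤m*n s s) (ℕP.m≤m+n (s ℕ.* s) 2))))
        R≤R*S : R ≤ R * S
        R≤R*S = subst (_≤ R * S) (ℤP.*-identityʳ R)
          (ℤP.*-monoˡ-≤-nonNeg R {{ℤ.nonNegative (nonneg-ℕ r)}} (+≤+ (ℕP.n≢0⇒n>0 (ℕ.≢-nonZero⁻¹ s))))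
        from-fundamental : u ≡ ε ⊎ GtQ M u ε → ⊥
        from-fundamental (inj₁ u≡ε) =
          contradiction (trans (sym u-norm) (trans (cong (normQ M) (trans u≡ε (sym η≡ε))) η-norm)) λ ()
        from-fundamental (inj₂ u>ε) = ¬Posℤ-nonPos (+ M) (S * S - T * S) (R - R * S) 0≤M
          (GtQ-scaled⇒Posℤ c 0<c M (S * S) R (T * S) (R * S) (subst (GtQ M u) ε≡scaled u>ε))
          (ℤP.i≤j⇒i-j≤0 S*S≤T*S) (ℤP.i≤j⇒i-j≤0 R≤R*S)

    conclusion : Conclusion
    conclusion = (λ t∸2-square → ⊥-elim (¬t∸2-square t∸2-square)) , (λ _ → trans η≡ η≡ε)

  module NormMinusOne (X-pell : X * X + + 4 ≡ + M * (Y * Y)) where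

    ε²≡ : sqQ M ε ≡ halves (X * X + + 2) (X * Y)
    ε²≡ = trans (cong (sqQ M) ε≡) (trans (scaled-mul M X Y X Y ½) (cong₂ mk
      (trans (cong (λ n → ι (X * X + n) Q.* (½ Q.* ½)) (sym X-pell))
        (trans (cong (λ n → ι n Q.* (½ Q.* ½)) (collect-re X)) (double-quarter (X * X + + 2))))
      (trans (cong (λ n → ι n Q.* (½ Q.* ½)) (collect-im X Y)) (double-quarter (X * Y)))))
      where
      collect-re : ∀ X → X * X + (X * X + + 4) ≡ + 2 * (X * X + + 2)
      collect-re = ℤSolver.solve-∀
      collect-im : ∀ X Y → X * Y + Y * X ≡ + 2 * (X * Y)
      collect-im = ℤSolver.solve-∀
      double-quarter : ∀ z → ι (+ 2 * z) Q.* (½ Q.* ½) ≡ ι z Q.* ½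
      double-quarter z = trans (cong (Q._* (½ Q.* ½)) (ι-homo-* (+ 2) z))
        (ℚSolver.+-*-Solver.solve 1 (λ a → (con (ι (+ 2)) :* a) :* (con ½ :* con ½) := a :* con ½) refl (ι z))
        where open ℚSolver.+-*-Solver

    t≤x²+2 : t ℕ.≤ x ℕ.* x ℕ.+ 2
    t≤x²+2 = ℕP.≮⇒≥ λ x²+2<t → minimal (x ℕ.* x ℕ.+ 2) (x ℕ.* y)
      (ℕP.≤-trans (s≤s z≤n) (ℕP.m≤n+m 2 (x ℕ.* x))) x²+2<t (ℕP.*-mono-≤ 0<x 0<y) ε²-pell
      where
      open import Data.Nat.Tactic.RingSolver using () renaming (solve-∀ to solveℕ-∀)
      expand : ∀ m → (m ℕ.+ 2) ℕ.* (m ℕ.+ 2) ≡ m ℕ.* (m ℕ.+ 4) ℕ.+ 4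
      expand = solveℕ-∀
      regroup : ∀ M x y → x ℕ.* x ℕ.* (M ℕ.* (y ℕ.* y)) ≡ M ℕ.* ((x ℕ.* y) ℕ.* (x ℕ.* y))
      regroup = solveℕ-∀
      ε²-pell : (x ℕ.* x ℕ.+ 2) ℕ.* (x ℕ.* x ℕ.+ 2) ≡ M ℕ.* ((x ℕ.* y) ℕ.* (x ℕ.* y)) ℕ.+ 4
      ε²-pell = trans (expand (x ℕ.* x)) (trans (cong (λ n → x ℕ.* x ℕ.* n ℕ.+ 4) (pell⁻ℤ⇒ℕ x y X-pell))
                  (cong (ℕ._+ 4) (regroup M x y)))

    ε²≡η-of-t≡x²+2 : t ≡ x ℕ.* x ℕ.+ 2 → sqQ M ε ≡ η
    ε²≡η-of-t≡x²+2 t≡ = trans ε²≡ (sym (cong₂ halves T≡ R≡XY))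
      where
      T≡ : T ≡ X * X + + 2
      T≡ = trans (cong +_ t≡) (trans (ℤP.pos-+ (x ℕ.* x) 2) (cong (_+ + 2) (ℤP.pos-* x x)))
      R≡XY : R ≡ X * Y
      R≡XY = square-injective 0<M (nonneg-ℕ r) (nonneg-* (nonneg-ℕ x) (nonneg-ℕ y)) (begin
        + M * (R * R)                    ≡⟨ ≡+4⇒-4≡ (T * T) (+ M * (R * R)) T-pell ⟩
        T * T - + 4                      ≡⟨ cong (λ z → z * z - + 4) T≡ ⟩
        (X * X + + 2) * (X * X + + 2) - + 4  ≡⟨ factor X ⟩
        X * X * (X * X + + 4)            ≡⟨ cong (X * X *_) X-pell ⟩
        X * X * (+ M * (Y * Y))          ≡⟨ regroup (+ M) X Y ⟩
        + M * ((X * Y) * (X * Y))        ∎)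
        where
        open ≡-Reasoning
        factor : ∀ X → (X * X + + 2) * (X * X + + 2) - + 4 ≡ X * X * (X * X + + 4)
        factor = ℤSolver.solve-∀
        regroup : ∀ M X Y → X * X * (M * (Y * Y)) ≡ M * ((X * Y) * (X * Y))
        regroup = ℤSolver.solve-∀

    η≢ε : η ≢ ε
    η≢ε η≡ε = contradiction (trans (sym η-norm) (trans (cong (normQ M) (trans η≡ε ε≡))
                (proj₂ (halves-unit-norm-1 M X Y X-pell)))) λ ()

    X<T : X < T
    X<T = [ ⊥-elim ∘ η≢ε , x<t-of-Posℤ X Y (nonneg-ℕ y) X-pell ∘ η>ε⇒Posℤ ]′ (fundamental η η-unit η>1)

    X≡₂MY : X ≡₂ + M * Y
    X≡₂MY = ≡₂-of-squares X Y (+ M) -[1+ 1 ] (square≡₂ x) (square≡₂ y)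
      (trans (subtract-4 (X * X)) (cong (_+ -[1+ 3 ]) X-pell))
      where
      subtract-4 : ∀ a → a ≡ a + + 4 + -[1+ 3 ]
      subtract-4 = ℤSolver.solve-∀

    T≡₂MR : T ≡₂ + M * R
    T≡₂MR = ≡₂-of-squares T R (+ M) (+ 2) (square≡₂ t) (square≡₂ r) T-pell

    α β : ℤ
    α = proj₁ (Mry-tx-even (+ M) T R X Y T≡₂MR X≡₂MY (square≡₂ M))
    β = proj₁ (ty-rx-even (+ M) T R X Y T≡₂MR X≡₂MY)

    2α≡ : + 2 * α ≡ + M * R * Y - T * X
    2α≡ = proj₂ (Mry-tx-even (+ M) T R X Y T≡₂MR X≡₂MY (square≡₂ M))

    2β≡ : + 2 * β ≡ T * Y - R * X
    2β≡ = proj₂ (ty-rx-even (+ M) T R X Y T≡₂MR X≡₂MY)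

    0<α : 0ℤ < α
    0<α = ℤP.*-cancelˡ-<-nonNeg (+ 2)
            (subst (0ℤ <_) (sym 2α≡) (<⇒0<-diff (tx<Mry X Y (nonneg-ℕ x) (nonneg-ℕ y) X-pell X<T)))

    0<β : 0ℤ < β
    0<β = ℤP.*-cancelˡ-<-nonNeg (+ 2) (subst (0ℤ <_) (sym 2β≡) (<⇒0<-diff (rx<ty X Y (nonneg-ℕ y) X-pell)))

    -- w = ηε⁻¹ = −ηε̄
    w : QF
    w = halves α β

    w-pell : α * α + + 4 ≡ + M * (β * β)
    w-pell = quotient-norm X Y α β X-pell 2α≡ 2β≡

    w>1 : GtQ M w oneQ
    w>1 = Posℤ⇒halves>1 M α β (Posℤ[norm-4] (+ M) α β 0<α 0<β w-pell)

    X≤α : X ≤ α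
    X≤α = [ (λ w≡ε → ℤP.≤-reflexive (sym (PositiveScale.*c-injective ½ 0<½ (cong re (trans w≡ε ε≡)))))
          , (λ w>ε → x≤a-of-Posℤ (+ M) α β X Y 0<M (ℤP.<⇒≤ 0<α) (nonneg-ℕ y) w-pell X-pell
                       (GtQ-halves⇒Posℤ M α β X Y (subst (GtQ M w) ε≡ w>ε)))
          ]′ (fundamental w (proj₁ (halves-unit-norm-1 M α β w-pell)) w>1)

    ¬t<x²+2 : ¬ (t ℕ.< x ℕ.* x ℕ.+ 2)
    ¬t<x²+2 t<x²+2 = ℤP.<⇒≱ (a<x-of-t<x²+2 X Y α (nonneg-ℕ x) X-pell 2α≡ T<X²+2) X≤α
      where
      T<X²+2 : T < X * X + + 2
      T<X²+2 = subst (T <_) (trans (ℤP.pos-+ (x ℕ.* x) 2) (cong (_+ + 2) (ℤP.pos-* x x))) (+<+ t<x²+2)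

    conclusion-of-t≡x²+2 : t ≡ x ℕ.* x ℕ.+ 2 → Conclusion
    conclusion-of-t≡x²+2 t≡x²+2 = (λ _ → trans η≡ (sym (ε²≡η-of-t≡x²+2 t≡x²+2)))
      , (λ ¬square → ⊥-elim (¬square (x , trans (cong (ℕ._∸ 2) t≡x²+2) (ℕP.m+n∸n≡m (x ℕ.* x) 2))))

    conclusion : Conclusion
    conclusion = [ ⊥-elim ∘ ¬t<x²+2 , conclusion-of-t≡x²+2 ]′ (ℕP.m≤n⇒m<n∨m≡n t≤x²+2)

  conclusion : Conclusion
  conclusion = [ NormPlusOne.conclusion , NormMinusOne.conclusion ]′ pell


open import Data.Nat using (ℕ; _+_; _*_; _∸_; _≤_; _<_; NonZero)
open import Data.Rational using (-_) renaming (_*_ to _*ℚ_)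

corollary4p3 :
  (∀ (t : ℕ) → 3 ≤ t →
    ((∃ λ u → IsUnit (t * t ∸ 4) u × normQ (t * t ∸ 4) u ≡ - 1ℚ
              × sqQ (t * t ∸ 4) u ≡ E₁ t)
      ⇔ (∃ λ (t' : ℕ) → 1 ≤ t' × t ≡ t' * t' + 2))
    × (∀ (t' : ℕ) .{{_ : NonZero t'}} → t ≡ t' * t' + 2 →
        E₁ t ≡ sqQ (t * t ∸ 4) (mk (+ t' / 2) ((+ 1 / t') *ℚ ½))))
  ×
  (∀ (t M r : ℕ) → 3 ≤ t → 2 ≤ M → SquareFree M → 1 ≤ r →
    t * t ≡ M * (r * r) + 4 →
    (∀ (t₁ r₁ : ℕ) → 1 ≤ t₁ → t₁ < t → 1 ≤ r₁ → ¬ (t₁ * t₁ ≡ M * (r₁ * r₁) + 4)) →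
    ∀ ε → IsFundamentalUnit M ε →
      (IsSquareℕ (t ∸ 2) → mk (+ t / 2) (+ r / 2) ≡ sqQ M ε)
      × (¬ IsSquareℕ (t ∸ 2) → mk (+ t / 2) (+ r / 2) ≡ ε))
corollary4p3 =
    (λ t 3≤t → SquareRootOfE₁.E₁-root⇔t∸2-square t 3≤t , SquareRootOfE₁.E₁≡square t)
  , MinimalSolution.conclusion
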